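{- For all partitions $\lambda$ and $\mu$, $$\langle \mathbf{p}_\lambda,\mathbf{p}_\mu\rangle_@=z_\lambda\,\delta_{\lambda\mu}.$$
   Context: $Sym=\mathbb{Q}[p_1,p_2,\ldots]$ is the ring of symmetric functions with $\deg p_k=k$, $p_\lambda=p_{\lambda_1}\cdots p_{\lambda_{\ell(\lambda)}}$, $z_\lambda=\prod_i m_i(\lambda)!\,i^{m_i(\lambda)}$ where $m_i(\lambda)$ is the multiplicity of $i$ as a part of $\lambda$. For a partition $\nu$, $\Xi_\nu$ is the multiset consisting, for each part $\nu_j$, of all $\nu_j$-th roots of unity, and $f[\Xi_\nu]$ is obtained from $f\in Sym$ by replacing each $p_k$ by the sum of $k$-th powers of the elements of $\Xi_\nu$. For $f,g\in Sym$, $\langle f,g\rangle_@$ denotes the common value of $\sum_{\nu\vdash n} f[\Xi_\nu]g[\Xi_\nu]/z_\nu$ for all $n\ge 2\max(\deg f,\deg g)$ (this value is independent of such $n$). For $i\ge1$ let $q_i=\frac1i\sum_{d\mid i}\mathrm{mob}(i/d)\,p_d$, where $\mathrm{mob}$ is the number-theoretic Möbius function, and let $(x)_r=x(x-1)\cdots(x-r+1)$ be the falling factorial. For $i,r\ge1$ set $\overline{\mathbf{p}}_{i^r}=i^r\,(q_i)_r$, and $\overline{\mathbf{p}}_{i^0}=1$; set $\mathbf{p}_{i^r}=\sum_{k=0}^r(-1)^{r-k}\binom rk\overline{\mathbf{p}}_{i^k}$. For a partition $\gamma$, $\mathbf{p}_\gamma=\prod_{i\ge1}\mathbf{p}_{i^{m_i(\gamma)}}$.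 -}

module Defs where

open import Data.Nat as ℕ using (ℕ; zero; suc; _∸_; _≤_; _⊔_)
open import Data.Nat.Divisibility using (_∣?_)
open import Data.Nat.Primality using (prime?)
open import Data.Nat.Combinatorics using (_C_)
open import Data.Nat.DivMod as DM using ()
open import Data.Integer as ℤ using (ℤ; +_)
open import Data.Rational as ℚ using (ℚ; 0ℚ; 1ℚ)
open import Data.Bool using (Bool; true; false; if_then_else_; not)
open import Data.List using (List; []; _∷_; map; foldr; length; filter; applyUpTo; upTo)
open import Data.List.Relation.Unary.All using (All)
open import Data.List.Relation.Unary.Linked using (Linked)
open import Data.Product using (_×_)
open import Relation.Nullary.Decidable using (⌊_⌋; _×-dec_)
open import Relation.Binary.PropositionalEquality using (_≡_)
import Data.List.Properties as LP
import Data.Nat.ListAction as NL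
open import Data.Bool.ListAction using (all)

IsPartition : List ℕ → Set
IsPartition ν = All (λ x → 0 ℕ.< x) ν × Linked ℕ._≥_ ν

size : List ℕ → ℕ
size = NL.sum

oneTo : ℕ → List ℕ
oneTo = applyUpTo suc

mult : ℕ → List ℕ → ℕ
mult i γ = length (filter (ℕ._≟ i) γ)

fromℕ : ℕ → ℚ
fromℕ n = + n ℚ./ 1

fromℤ : ℤ → ℚ
fromℤ z = z ℚ./ 1

sumℚ : List ℚ → ℚ
sumℚ = foldr ℚ._+_ 0ℚ

prodℚ : List ℚ → ℚ
prodℚ = foldr ℚ._*_ 1ℚ

signℚ : ℕ → ℚ
signℚ zero    = 1ℚ
signℚ (suc k) = ℚ.- signℚ k

falling : ℚ → ℕ → ℚ
falling x zero    = 1ℚ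
falling x (suc r) = falling x r ℚ.* (x ℚ.- fromℕ r)

-- z_λ = ∏_i m_i(λ)! i^{m_i(λ)}  (parts are ≤ |λ|, so i ranges over 1..|λ|)

zee : List ℕ → ℕ
zee γ = NL.product
          (map (λ i → (mult i γ) ℕ.! ℕ.* (i ℕ.^ mult i γ)) (oneTo (size γ)))

squarefree : ℕ → Bool
squarefree n = all (λ d → not ⌊ (d ℕ.* d) ∣? n ⌋) (applyUpTo (λ j → 2 ℕ.+ j) (n ∸ 1))

numPrimeDivisors : ℕ → ℕ
numPrimeDivisors n = length (filter (λ p → prime? p ×-dec p ∣? n) (oneTo n))

signℤ : ℕ → ℤ
signℤ zero    = + 1
signℤ (suc k) = ℤ.- signℤ k

mob : ℕ → ℤ
mob n = if squarefree n then signℤ (numPrimeDivisors n) else + 0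

-- Evaluation at Ξ_ν.
-- p_k[Ξ_ν] = Σ_j Σ_{ζ^{ν_j} = 1} ζ^k = Σ_j (ν_j if ν_j ∣ k, else 0).

pAt : List ℕ → ℕ → ℚ
pAt ν k = fromℕ (NL.sum (map (λ a → if ⌊ a ∣? k ⌋ then a else 0) ν))

qAt : List ℕ → ℕ → ℚ
qAt ν zero = 0ℚ
qAt ν (suc i) =
  (+ 1 ℚ./ suc i) ℚ.*
  sumℚ (map (λ d → if ⌊ suc d ∣? suc i ⌋
                   then fromℤ (mob (suc i DM./ suc d)) ℚ.* pAt ν (suc d)
                   else 0ℚ)
            (upTo (suc i)))

pbarAt : List ℕ → ℕ → ℕ → ℚ
pbarAt ν i r = fromℕ (i ℕ.^ r) ℚ.* falling (qAt ν i) r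

pPowAt : List ℕ → ℕ → ℕ → ℚ
pPowAt ν i r = sumℚ (map (λ k → signℚ (r ∸ k) ℚ.* fromℕ (r C k) ℚ.* pbarAt ν i k)
                         (upTo (suc r)))

pBoldAt : List ℕ → List ℕ → ℚ
pBoldAt γ ν = prodℚ (map (λ i → pPowAt ν i (mult i γ)) (oneTo (size γ)))

invZ : List ℕ → ℚ
invZ ν with zee ν
... | zero  = 0ℚ
... | suc k = + 1 ℚ./ suc k

atSum : List ℕ → List ℕ → List (List ℕ) → ℚ
atSum γ δ L = sumℚ (map (λ ν → pBoldAt γ ν ℚ.* pBoldAt δ ν ℚ.* invZ ν) L)

zDelta : List ℕ → List ℕ → ℚ
zDelta γ δ = if ⌊ LP.≡-dec ℕ._≟_ γ δ ⌋ then fromℕ (zee γ) else 0ℚ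

-- At Ξ_ν, p_d takes the value Σ_{ν_j ∣ d} ν_j = Σ_{e ∣ d} e m_e(ν), so Möbius inversion gives q_i[Ξ_ν] = m_i(ν)
-- and p_{i^r}[Ξ_ν] = C_{i,r}(m_i(ν)) for the Charlier-type polynomial C_{i,r}(x) = Σ_k (-1)^{r-k} C(r,k) i^k (x)_k.
-- Hence, with a_i = m_i(λ) and b_i = m_i(μ), ⟨p_λ, p_μ⟩_@ is the sum over ν ⊢ n of
-- ∏_i C_{i,a_i}(m_i) C_{i,b_i}(m_i) / (m_i! i^{m_i}), the coefficient of tⁿ in a product over i of series in t^i.
-- The recurrence C_{i,a+1}(x) = i x C_{i,a}(x-1) - C_{i,a}(x) and the difference ΔC_{i,b} = i b C_{i,b-1}
-- rewrite such a sum through sums of smaller total degree Σ_i (a_i + b_i), at n and at n - i (the factor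
-- x / (x! i^x) shifts the i-th series by t^i).  By induction, down to Σ_{ν ⊢ n} 1/z_ν = 1, the sum is
-- ∏_i δ_{a_i b_i} a_i! i^{a_i} = z_λ δ_{λμ} as long as n ≥ Σ_i i (a_i + b_i) = |λ| + |μ|, which n ≥ 2 max(|λ|, |μ|) ensures.

module Submission where

open import Defs
open import Algebra.Bundles using (CommutativeMonoid)
open import Data.Bool using (Bool; true; false; T; not; if_then_else_)
open import Data.Integer as ℤ using (-[1+_])
import Data.Integer.Properties as ℤP
open import Data.List using (List; []; _∷_; map; applyUpTo; upTo; _++_; filter; length; replicate; concat; concatMap)
import Data.List.Properties as LP
open import Data.List.Membership.Propositional using (_∈_; _∉_)
import Data.List.Membership.Propositional.Properties as ∈P
open import Data.List.Membership.Propositional.Properties.WithK using (unique∧set⇒bag)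
open import Data.List.Relation.Binary.BagAndSetEquality using (∼bag⇒↭)
open import Data.List.Relation.Binary.Permutation.Propositional using (_↭_; refl; prep; swap; trans)
open import Data.List.Relation.Binary.Permutation.Propositional.Properties using (↭-length)
open import Data.List.Relation.Unary.All as All using (All; []; _∷_)
import Data.List.Relation.Unary.All.Properties as AllP
open import Data.List.Relation.Unary.AllPairs as AllPairs using ([]; _∷_)
import Data.List.Relation.Unary.AllPairs.Properties as AllPairsP
open import Data.List.Relation.Unary.Any using (here; there)
open import Data.List.Relation.Unary.Linked using (Linked; []; [-]; _∷_)
import Data.List.Relation.Unary.Linked.Properties as LinkedP
open import Data.List.Relation.Unary.Unique.Propositional using (Unique)
import Data.List.Relation.Unary.Unique.Propositional.Properties as UniqueP
open import Data.Nat as ℕ using (ℕ; zero; suc; z≤n; s≤s; _∸_; _≤_; _<_; _≤?_; _<?_; _/_; _!; _^_; _⊔_)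
open import Data.Nat.Combinatorics using (_C_; nCk+nC[k+1]≡[n+1]C[k+1]; k>n⇒nCk≡0)
open import Data.Nat.Coprimality using (Coprime; coprime-divisor; 1-coprimeTo) renaming (sym to coprime-sym)
open import Data.Nat.Divisibility
  using (_∣_; _∣?_; divides; ∣-refl; ∣-trans; 0∣⇒≡0; ∣⇒≤; ∣n⇒∣m*n; n∣m*n; m∣m*n; *-cancelˡ-∣; *-monoʳ-∣; n/m≡quotient)
open import Data.Nat.Divisibility.Core using (hasNonTrivialDivisor)
open import Data.Nat.Induction using (<-rec)
import Data.Nat.ListAction as NL
open import Data.Nat.Primality
  using (Prime; prime?; prime⇒nonZero; prime⇒nonTrivial; prime⇒irreducible; ¬prime⇒composite; ¬prime[1]; euclidsLemma)
import Data.Nat.Properties as ℕP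
open import Data.Nat.Tactic.RingSolver using (solve-∀)
open import Data.Product using (_×_; _,_; proj₁; proj₂; ∃-syntax)
open import Data.Rational as ℚ using (ℚ; 0ℚ; 1ℚ; _+_; _*_; -_; _-_; mkℚ)
import Data.Rational.Properties as ℚP
open import Data.Rational.Solver using (module +-*-Solver)
open import Data.Sum using (inj₁; inj₂)
open import Data.Unit using (⊤; tt)
open import Function.Base using (_∘_; id)
open import Function.Bundles using (_⇔_; mk⇔; Equivalence)
open import Relation.Binary.Definitions using (tri<; tri≈; tri>)
open import Relation.Binary.PropositionalEquality
  using (_≡_; _≢_; refl; sym; cong; cong₂; subst; module ≡-Reasoning)
  renaming (trans to ≡-trans)
open import Relation.Nullary using (Dec; yes; no; ¬_; contradiction)
open import Relation.Nullary.Decidable using (⌊_⌋; _×-dec_; ¬?; toWitnessFalse; fromWitnessFalse)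

open +-*-Solver
import Algebra.Properties.CommutativeSemigroup (CommutativeMonoid.commutativeSemigroup ℚP.+-0-commutativeMonoid) as ℚ+
import Algebra.Properties.CommutativeSemigroup (CommutativeMonoid.commutativeSemigroup ℚP.*-1-commutativeMonoid) as ℚ*
import Algebra.Properties.CommutativeSemigroup ℕP.+-commutativeSemigroup as ℕ+

fromℤ-mkℚ : ∀ z → fromℤ z ≡ mkℚ z 0 (coprime-sym (1-coprimeTo ℤ.∣ z ∣))
fromℤ-mkℚ (ℤ.+ n)  = ℚP.normalize-coprime (coprime-sym (1-coprimeTo n))
fromℤ-mkℚ -[1+ n ] = cong -_ (ℚP.normalize-coprime (coprime-sym (1-coprimeTo (suc n))))

fromℤ-homo-+ : ∀ a b → fromℤ (a ℤ.+ b) ≡ fromℤ a + fromℤ b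
fromℤ-homo-+ a b = begin
  fromℤ (a ℤ.+ b)                  ≡⟨ cong (ℚ._/ 1) (cong₂ ℤ._+_ (sym (ℤP.*-identityʳ a)) (sym (ℤP.*-identityʳ b))) ⟩
  (a ℤ.* ℤ.+ 1 ℤ.+ b ℤ.* ℤ.+ 1) ℚ./ 1 ≡⟨ cong₂ _+_ (fromℤ-mkℚ a) (fromℤ-mkℚ b) ⟨
  fromℤ a + fromℤ b                ∎
  where open ≡-Reasoning

fromℤ-homo-* : ∀ a b → fromℤ (a ℤ.* b) ≡ fromℤ a * fromℤ b
fromℤ-homo-* a b = sym (cong₂ _*_ (fromℤ-mkℚ a) (fromℤ-mkℚ b))

fromℤ-homo‿- : ∀ a → fromℤ (ℤ.- a) ≡ - fromℤ a
fromℤ-homo‿- a = ≡-trans (fromℤ-mkℚ (ℤ.- a)) (≡-trans (mkℚ-neg a) (cong -_ (sym (fromℤ-mkℚ a))))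
  where
  mkℚ-neg : ∀ a → mkℚ (ℤ.- a) 0 (coprime-sym (1-coprimeTo ℤ.∣ ℤ.- a ∣))
                ≡ - mkℚ a 0 (coprime-sym (1-coprimeTo ℤ.∣ a ∣))
  mkℚ-neg (ℤ.+ zero)  = refl
  mkℚ-neg (ℤ.+ suc n) = refl
  mkℚ-neg -[1+ n ]   = refl

fromℕ-homo-+ : ∀ a b → fromℕ (a ℕ.+ b) ≡ fromℕ a + fromℕ b
fromℕ-homo-+ a b = fromℤ-homo-+ (ℤ.+ a) (ℤ.+ b)

fromℕ-homo-* : ∀ a b → fromℕ (a ℕ.* b) ≡ fromℕ a * fromℕ b
fromℕ-homo-* a b = ≡-trans (cong fromℤ (ℤP.pos-* a b)) (fromℤ-homo-* (ℤ.+ a) (ℤ.+ b))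

fromℕ-suc : ∀ a → fromℕ (suc a) ≡ 1ℚ + fromℕ a
fromℕ-suc = fromℕ-homo-+ 1

-- recip 0 = 0 is a junk value, as in invZ.
recip : ℕ → ℚ
recip zero    = 0ℚ
recip (suc k) = ℤ.+ 1 ℚ./ suc k

fromℕ-*-recip : ∀ k → fromℕ (suc k) * recip (suc k) ≡ 1ℚ
fromℕ-*-recip k =
  ≡-trans (cong₂ _*_ (fromℤ-mkℚ (ℤ.+ suc k)) (ℚP.normalize-coprime (1-coprimeTo (suc k))))
          (ℚP.*-inverseʳ (mkℚ (ℤ.+ suc k) 0 (coprime-sym (1-coprimeTo (suc k)))))

recip-*-fromℕ-* : ∀ k z → recip (suc k) * (fromℕ (suc k) * z) ≡ z
recip-*-fromℕ-* k z = begin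
  r * (n * z) ≡⟨ solve 3 (λ r n z → r :* (n :* z) := (n :* r) :* z) refl r n z ⟩
  (n * r) * z ≡⟨ cong (_* z) (fromℕ-*-recip k) ⟩
  1ℚ * z      ≡⟨ ℚP.*-identityˡ z ⟩
  z           ∎
  where
  open ≡-Reasoning
  r = recip (suc k)
  n = fromℕ (suc k)

fromℕ-*-cancelˡ : ∀ k {x y} → fromℕ (suc k) * x ≡ fromℕ (suc k) * y → x ≡ y
fromℕ-*-cancelˡ k {x} {y} eq = begin
  x                                   ≡⟨ recip-*-fromℕ-* k x ⟨
  recip (suc k) * (fromℕ (suc k) * x) ≡⟨ cong (recip (suc k) *_) eq ⟩
  recip (suc k) * (fromℕ (suc k) * y) ≡⟨ recip-*-fromℕ-* k y ⟩
  y                                   ∎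
  where open ≡-Reasoning

recip-homo-* : ∀ a b → recip (a ℕ.* b) ≡ recip a * recip b
recip-homo-* zero    b       = sym (ℚP.*-zeroˡ (recip b))
recip-homo-* (suc a) zero    = ≡-trans (cong recip (ℕP.*-zeroʳ a)) (sym (ℚP.*-zeroʳ (recip (suc a))))
recip-homo-* (suc a) (suc b) = fromℕ-*-cancelˡ (b ℕ.+ a ℕ.* suc b) (begin
  fromℕ (suc a ℕ.* suc b) * recip (suc a ℕ.* suc b) ≡⟨ fromℕ-*-recip (b ℕ.+ a ℕ.* suc b) ⟩
  1ℚ                                                ≡⟨ cong₂ _*_ (fromℕ-*-recip a) (fromℕ-*-recip b) ⟨
  (A * recip (suc a)) * (B * recip (suc b))         ≡⟨ solve 4 (λ x y u v → (x :* u) :* (y :* v) := x :* y :* (u :* v)) refl A B (recip (suc a)) (recip (suc b)) ⟩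
  A * B * (recip (suc a) * recip (suc b))           ≡⟨ cong (_* (recip (suc a) * recip (suc b))) (fromℕ-homo-* (suc a) (suc b)) ⟨
  fromℕ (suc a ℕ.* suc b) * (recip (suc a) * recip (suc b)) ∎)
  where
  open ≡-Reasoning
  A = fromℕ (suc a)
  B = fromℕ (suc b)

if-⌊yes⌋ : ∀ {P : Set} (P? : Dec P) {x y : ℚ} → P → (if ⌊ P? ⌋ then x else y) ≡ x
if-⌊yes⌋ (yes _) _ = refl
if-⌊yes⌋ (no ¬p) p = contradiction p ¬p

if-⌊no⌋ : ∀ {P : Set} (P? : Dec P) {x y : ℚ} → ¬ P → (if ⌊ P? ⌋ then x else y) ≡ y
if-⌊no⌋ (yes p) ¬p = contradiction p ¬p
if-⌊no⌋ (no _)  _  = refl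

+≤⇒≤∸ : ∀ b {c n} → b ℕ.+ c ≤ n → c ≤ n ∸ b
+≤⇒≤∸ b {c} {n} b+c≤n = ℕP.m+n≤o⇒m≤o∸n c (subst (_≤ n) (ℕP.+-comm b c) b+c≤n)

≤∸⇒+≤ : ∀ b {c n} → b ≤ n → c ≤ n ∸ b → b ℕ.+ c ≤ n
≤∸⇒+≤ b {c} {n} b≤n c≤n∸b = subst (_≤ n) (ℕP.+-comm c b) (ℕP.m≤o∸n⇒m+n≤o c b≤n c≤n∸b)

∸-comm : ∀ n a b → n ∸ a ∸ b ≡ n ∸ b ∸ a
∸-comm n a b = ≡-trans (ℕP.∸-+-assoc n a b) (≡-trans (cong (n ∸_) (ℕP.+-comm a b)) (sym (ℕP.∸-+-assoc n b a)))

_[_≔_] : ∀ {A : Set} → (ℕ → A) → ℕ → A → ℕ → A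
(f [ i ≔ v ]) j with j ℕ.≟ i
... | yes _ = v
... | no  _ = f j

≔-same : ∀ {A : Set} (f : ℕ → A) i v → (f [ i ≔ v ]) i ≡ v
≔-same f i v with i ℕ.≟ i
... | yes _   = refl
... | no  i≢i = contradiction refl i≢i

≔-other : ∀ {A : Set} (f : ℕ → A) i v {j} → j ≢ i → (f [ i ≔ v ]) j ≡ f j
≔-other f i v {j} j≢i with j ℕ.≟ i
... | yes j≡i = contradiction j≡i j≢i
... | no  _   = refl

when : ∀ {P : Set} → Dec P → ℚ → ℚ
when (yes _) x = x
when (no  _) _ = 0ℚ

when-yes : ∀ {P : Set} (P? : Dec P) x → P → when P? x ≡ x
when-yes (yes _) x _ = refl
when-yes (no ¬p) x p = contradiction p ¬p

when-no : ∀ {P : Set} (P? : Dec P) x → ¬ P → when P? x ≡ 0ℚ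
when-no (yes p) x ¬p = contradiction p ¬p
when-no (no _)  x _  = refl

when-⇔ : ∀ {P Q : Set} (P? : Dec P) (Q? : Dec Q) → (P → Q) → (Q → P) → ∀ {x y} → (P → x ≡ y) → when P? x ≡ when Q? y
when-⇔ (yes p) (yes _) _ _ eq = eq p
when-⇔ (yes p) (no ¬q) f _ _  = contradiction (f p) ¬q
when-⇔ (no ¬p) (yes q) _ g _  = contradiction (g q) ¬p
when-⇔ (no _)  (no _)  _ _ _  = refl

when-zero : ∀ {P : Set} (P? : Dec P) {x} → x ≡ 0ℚ → when P? x ≡ 0ℚ
when-zero (yes _) x≡0 = x≡0
when-zero (no _)  _   = refl

when-linear : ∀ {P : Set} (P? : Dec P) x c y → when P? (x + c * y) ≡ when P? x + c * when P? y
when-linear (yes _) x c y = refl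
when-linear (no _)  x c y = solve 1 (λ c → con 0ℚ := con 0ℚ :+ c :* con 0ℚ) refl c

-- Finite sums and products

∑ : (ℕ → ℚ) → ℕ → ℚ
∑ f zero    = 0ℚ
∑ f (suc n) = f 0 + ∑ (λ j → f (suc j)) n

∏ : (ℕ → ℚ) → ℕ → ℚ
∏ f zero    = 1ℚ
∏ f (suc n) = f 0 * ∏ (λ j → f (suc j)) n

syntax ∑ (λ j → e) n = ∑[ j < n ] e
syntax ∏ (λ j → e) n = ∏[ j < n ] e

∑-cong : ∀ {f g} n → (∀ j → j < n → f j ≡ g j) → ∑ f n ≡ ∑ g n
∑-cong zero    eq = refl
∑-cong (suc n) eq = cong₂ _+_ (eq 0 (s≤s z≤n)) (∑-cong n (λ j j<n → eq (suc j) (s≤s j<n)))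

∏-cong : ∀ {f g} n → (∀ j → j < n → f j ≡ g j) → ∏ f n ≡ ∏ g n
∏-cong zero    eq = refl
∏-cong (suc n) eq = cong₂ _*_ (eq 0 (s≤s z≤n)) (∏-cong n (λ j j<n → eq (suc j) (s≤s j<n)))

∑-zero : ∀ f n → (∀ j → j < n → f j ≡ 0ℚ) → ∑ f n ≡ 0ℚ
∑-zero f zero    eq = refl
∑-zero f (suc n) eq = cong₂ _+_ (eq 0 (s≤s z≤n)) (∑-zero (λ j → f (suc j)) n (λ j j<n → eq (suc j) (s≤s j<n)))

∏-one : ∀ f n → (∀ j → j < n → f j ≡ 1ℚ) → ∏ f n ≡ 1ℚ
∏-one f zero    eq = refl
∏-one f (suc n) eq = cong₂ _*_ (eq 0 (s≤s z≤n)) (∏-one (λ j → f (suc j)) n (λ j j<n → eq (suc j) (s≤s j<n)))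

∑-distrib-+ : ∀ f g n → ∑[ j < n ] (f j + g j) ≡ ∑ f n + ∑ g n
∑-distrib-+ f g zero    = refl
∑-distrib-+ f g (suc n) =
  ≡-trans (cong (λ s → f 0 + g 0 + s) (∑-distrib-+ (λ j → f (suc j)) (λ j → g (suc j)) n))
          (ℚ+.interchange (f 0) (g 0) _ _)

∏-distrib-* : ∀ f g n → ∏[ j < n ] (f j * g j) ≡ ∏ f n * ∏ g n
∏-distrib-* f g zero    = refl
∏-distrib-* f g (suc n) =
  ≡-trans (cong (λ s → f 0 * g 0 * s) (∏-distrib-* (λ j → f (suc j)) (λ j → g (suc j)) n))
          (ℚ*.interchange (f 0) (g 0) _ _)

∑-distribˡ : ∀ c f n → ∑[ j < n ] (c * f j) ≡ c * ∑ f n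
∑-distribˡ c f zero    = sym (ℚP.*-zeroʳ c)
∑-distribˡ c f (suc n) =
  ≡-trans (cong (c * f 0 +_) (∑-distribˡ c (λ j → f (suc j)) n)) (sym (ℚP.*-distribˡ-+ c _ _))

∑-neg : ∀ f n → ∑[ j < n ] (- f j) ≡ - ∑ f n
∑-neg f zero    = refl
∑-neg f (suc n) = ≡-trans (cong (- f 0 +_) (∑-neg (λ j → f (suc j)) n)) (sym (ℚP.neg-distrib-+ (f 0) _))

∑-init-last : ∀ f n → ∑ f (suc n) ≡ ∑ f n + f n
∑-init-last f zero    = ℚP.+-comm (f 0) 0ℚ
∑-init-last f (suc n) =
  ≡-trans (cong (f 0 +_) (∑-init-last (λ j → f (suc j)) n)) (sym (ℚP.+-assoc (f 0) _ _))

∏-init-last : ∀ f n → ∏ f (suc n) ≡ ∏ f n * f n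
∏-init-last f zero    = ℚP.*-comm (f 0) 1ℚ
∏-init-last f (suc n) =
  ≡-trans (cong (f 0 *_) (∏-init-last (λ j → f (suc j)) n)) (sym (ℚP.*-assoc (f 0) _ _))

∑-truncate : ∀ f M N → (∀ j → M ≤ j → f j ≡ 0ℚ) → M ≤ N → ∑ f N ≡ ∑ f M
∑-truncate f M zero    eq z≤n = refl
∑-truncate f M (suc N) eq M≤1+N with M ℕ.≟ suc N
... | yes refl = refl
... | no  M≢   = begin
  ∑ f (suc N)   ≡⟨ ∑-init-last f N ⟩
  ∑ f N + f N   ≡⟨ cong₂ _+_ (∑-truncate f M N eq M≤N) (eq N M≤N) ⟩
  ∑ f M + 0ℚ    ≡⟨ ℚP.+-identityʳ _ ⟩
  ∑ f M         ∎
  where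
  open ≡-Reasoning
  M≤N = ℕP.≤-pred (ℕP.≤∧≢⇒< M≤1+N M≢)

∏-truncate : ∀ f M N → (∀ j → M ≤ j → f j ≡ 1ℚ) → M ≤ N → ∏ f N ≡ ∏ f M
∏-truncate f M zero    eq z≤n = refl
∏-truncate f M (suc N) eq M≤1+N with M ℕ.≟ suc N
... | yes refl = refl
... | no  M≢   = begin
  ∏ f (suc N)   ≡⟨ ∏-init-last f N ⟩
  ∏ f N * f N   ≡⟨ cong₂ _*_ (∏-truncate f M N eq M≤N) (eq N M≤N) ⟩
  ∏ f M * 1ℚ    ≡⟨ ℚP.*-identityʳ _ ⟩
  ∏ f M         ∎
  where
  open ≡-Reasoning
  M≤N = ℕP.≤-pred (ℕP.≤∧≢⇒< M≤1+N M≢)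

∏-zeroFactor : ∀ f n i → i < n → f i ≡ 0ℚ → ∏ f n ≡ 0ℚ
∏-zeroFactor f (suc n) zero    _         eq =
  ≡-trans (cong (_* ∏ (λ j → f (suc j)) n) eq) (ℚP.*-zeroˡ (∏ (λ j → f (suc j)) n))
∏-zeroFactor f (suc n) (suc i) (s≤s i<n) eq =
  ≡-trans (cong (f 0 *_) (∏-zeroFactor (λ j → f (suc j)) n i i<n eq)) (ℚP.*-zeroʳ (f 0))

∏-scaleAt : ∀ f g c n i → i < n → f i ≡ c * g i → (∀ j → j < n → j ≢ i → f j ≡ g j) →
            ∏ f n ≡ c * ∏ g n
∏-scaleAt f g c (suc n) zero    _         eqᵢ eq =
  ≡-trans (cong₂ _*_ eqᵢ (∏-cong n (λ j j<n → eq (suc j) (s≤s j<n) λ ())))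
          (ℚP.*-assoc c _ _)
∏-scaleAt f g c (suc n) (suc i) (s≤s i<n) eqᵢ eq =
  ≡-trans (cong₂ _*_ (eq 0 (s≤s z≤n) λ ())
                     (∏-scaleAt (λ j → f (suc j)) (λ j → g (suc j)) c n i i<n eqᵢ
                                (λ j j<n j≢i → eq (suc j) (s≤s j<n) (λ e → j≢i (ℕP.suc-injective e)))))
          (ℚ*.x∙yz≈y∙xz (g 0) c _)

∑-comm : ∀ (f : ℕ → ℕ → ℚ) K N → ∑[ j < K ] ∑[ m < N ] f j m ≡ ∑[ m < N ] ∑[ j < K ] f j m
∑-comm f zero    N = sym (∑-zero (λ _ → 0ℚ) N (λ _ _ → refl))
∑-comm f (suc K) N =
  ≡-trans (cong (∑ (f 0) N +_) (∑-comm (λ j → f (suc j)) K N))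
          (sym (∑-distrib-+ (f 0) (λ m → ∑[ j < K ] f (suc j) m) N))

∑-const-1 : ∀ n → ∑ (λ _ → 1ℚ) n ≡ fromℕ n
∑-const-1 zero    = refl
∑-const-1 (suc n) = ≡-trans (cong (1ℚ +_) (∑-const-1 n)) (sym (fromℕ-suc n))

∑ℕ : (ℕ → ℕ) → ℕ → ℕ
∑ℕ f zero    = 0
∑ℕ f (suc n) = f 0 ℕ.+ ∑ℕ (λ j → f (suc j)) n

syntax ∑ℕ (λ j → e) n = ∑ℕ[ j < n ] e

∑ℕ-cong : ∀ {f g} n → (∀ j → j < n → f j ≡ g j) → ∑ℕ f n ≡ ∑ℕ g n
∑ℕ-cong zero    eq = refl
∑ℕ-cong (suc n) eq = cong₂ ℕ._+_ (eq 0 (s≤s z≤n)) (∑ℕ-cong n (λ j j<n → eq (suc j) (s≤s j<n)))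

∑ℕ-mono-≤ : ∀ {f g} n → (∀ j → j < n → f j ≤ g j) → ∑ℕ f n ≤ ∑ℕ g n
∑ℕ-mono-≤ zero    le = z≤n
∑ℕ-mono-≤ (suc n) le = ℕP.+-mono-≤ (le 0 (s≤s z≤n)) (∑ℕ-mono-≤ n (λ j j<n → le (suc j) (s≤s j<n)))

∑ℕ-zero : ∀ f n → (∀ j → j < n → f j ≡ 0) → ∑ℕ f n ≡ 0
∑ℕ-zero f zero    eq = refl
∑ℕ-zero f (suc n) eq = cong₂ ℕ._+_ (eq 0 (s≤s z≤n)) (∑ℕ-zero (λ j → f (suc j)) n (λ j j<n → eq (suc j) (s≤s j<n)))

∑ℕ-distrib-+ : ∀ f g n → ∑ℕ[ j < n ] (f j ℕ.+ g j) ≡ ∑ℕ f n ℕ.+ ∑ℕ g n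
∑ℕ-distrib-+ f g zero    = refl
∑ℕ-distrib-+ f g (suc n) =
  ≡-trans (cong (f 0 ℕ.+ g 0 ℕ.+_) (∑ℕ-distrib-+ (λ j → f (suc j)) (λ j → g (suc j)) n))
          (ℕ+.interchange (f 0) (g 0) _ _)

∑ℕ-addAt : ∀ f g c n i → i < n → f i ≡ c ℕ.+ g i → (∀ j → j < n → j ≢ i → f j ≡ g j) →
           ∑ℕ f n ≡ c ℕ.+ ∑ℕ g n
∑ℕ-addAt f g c (suc n) zero    _         eqᵢ eq =
  ≡-trans (cong₂ ℕ._+_ eqᵢ (∑ℕ-cong n (λ j j<n → eq (suc j) (s≤s j<n) λ ()))) (ℕP.+-assoc c _ _)
∑ℕ-addAt f g c (suc n) (suc i) (s≤s i<n) eqᵢ eq =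
  ≡-trans (cong₂ ℕ._+_ (eq 0 (s≤s z≤n) λ ())
                       (∑ℕ-addAt (λ j → f (suc j)) (λ j → g (suc j)) c n i i<n eqᵢ
                                 (λ j j<n j≢i → eq (suc j) (s≤s j<n) (λ e → j≢i (ℕP.suc-injective e)))))
          (ℕ+.x∙yz≈y∙xz (g 0) c _)

term≤∑ℕ : ∀ f n j → j < n → f j ≤ ∑ℕ f n
term≤∑ℕ f (suc n) zero    _         = ℕP.m≤m+n (f 0) _
term≤∑ℕ f (suc n) (suc j) (s≤s j<n) = ℕP.≤-trans (term≤∑ℕ (λ x → f (suc x)) n j j<n) (ℕP.m≤n+m _ (f 0))

sumℚ-applyUpTo : ∀ (f : ℕ → ℚ) g n → sumℚ (map f (applyUpTo g n)) ≡ ∑[ j < n ] f (g j)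
sumℚ-applyUpTo f g zero    = refl
sumℚ-applyUpTo f g (suc n) = cong (f (g 0) +_) (sumℚ-applyUpTo f (λ j → g (suc j)) n)

prodℚ-applyUpTo : ∀ (f : ℕ → ℚ) g n → prodℚ (map f (applyUpTo g n)) ≡ ∏[ j < n ] f (g j)
prodℚ-applyUpTo f g zero    = refl
prodℚ-applyUpTo f g (suc n) = cong (f (g 0) *_) (prodℚ-applyUpTo f (λ j → g (suc j)) n)

module _ {A : Set} where

  sumℚ-++ : ∀ (F : A → ℚ) xs ys → sumℚ (map F (xs ++ ys)) ≡ sumℚ (map F xs) + sumℚ (map F ys)
  sumℚ-++ F []       ys = sym (ℚP.+-identityˡ _)
  sumℚ-++ F (x ∷ xs) ys = ≡-trans (cong (F x +_) (sumℚ-++ F xs ys)) (sym (ℚP.+-assoc (F x) _ _))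

  sumℚ-concat : ∀ (F : A → ℚ) xss → sumℚ (map F (concat xss)) ≡ sumℚ (map (λ xs → sumℚ (map F xs)) xss)
  sumℚ-concat F []         = refl
  sumℚ-concat F (xs ∷ xss) = ≡-trans (sumℚ-++ F xs (concat xss)) (cong (sumℚ (map F xs) +_) (sumℚ-concat F xss))

  sumℚ-cong : ∀ {F G : A → ℚ} xs → (∀ {x} → x ∈ xs → F x ≡ G x) → sumℚ (map F xs) ≡ sumℚ (map G xs)
  sumℚ-cong []       eq = refl
  sumℚ-cong (x ∷ xs) eq = cong₂ _+_ (eq (here refl)) (sumℚ-cong xs (eq ∘ there))

  sumℚ-zero : ∀ (F : A → ℚ) xs → (∀ {x} → x ∈ xs → F x ≡ 0ℚ) → sumℚ (map F xs) ≡ 0ℚ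
  sumℚ-zero F []       eq = refl
  sumℚ-zero F (x ∷ xs) eq = cong₂ _+_ (eq (here refl)) (sumℚ-zero F xs (eq ∘ there))

  sumℚ-distribˡ : ∀ c (F : A → ℚ) xs → sumℚ (map (λ x → c * F x) xs) ≡ c * sumℚ (map F xs)
  sumℚ-distribˡ c F []       = sym (ℚP.*-zeroʳ c)
  sumℚ-distribˡ c F (x ∷ xs) =
    ≡-trans (cong (c * F x +_) (sumℚ-distribˡ c F xs)) (sym (ℚP.*-distribˡ-+ c (F x) _))

  sumℚ-distrib-+ : ∀ (F G : A → ℚ) xs → sumℚ (map (λ x → F x + G x) xs) ≡ sumℚ (map F xs) + sumℚ (map G xs)
  sumℚ-distrib-+ F G []       = refl
  sumℚ-distrib-+ F G (x ∷ xs) =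
    ≡-trans (cong (λ s → F x + G x + s) (sumℚ-distrib-+ F G xs)) (ℚ+.interchange (F x) (G x) _ _)

  sumℚ-neg : ∀ (F : A → ℚ) xs → sumℚ (map (λ x → - F x) xs) ≡ - sumℚ (map F xs)
  sumℚ-neg F []       = refl
  sumℚ-neg F (x ∷ xs) = ≡-trans (cong (- F x +_) (sumℚ-neg F xs)) (sym (ℚP.neg-distrib-+ (F x) _))

  sumℚ-filter : ∀ {P : A → Set} (P? : ∀ x → Dec (P x)) (F : A → ℚ) xs →
    sumℚ (map (λ x → if ⌊ P? x ⌋ then F x else 0ℚ) xs) ≡ sumℚ (map F (filter P? xs))
  sumℚ-filter P? F []       = refl
  sumℚ-filter P? F (x ∷ xs) with P? x
  ... | yes _ = cong (F x +_) (sumℚ-filter P? F xs)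
  ... | no  _ = ≡-trans (ℚP.+-identityˡ _) (sumℚ-filter P? F xs)

  sumℚ-↭ : ∀ (F : A → ℚ) {xs ys} → xs ↭ ys → sumℚ (map F xs) ≡ sumℚ (map F ys)
  sumℚ-↭ F refl          = refl
  sumℚ-↭ F (prep x p)    = cong (F x +_) (sumℚ-↭ F p)
  sumℚ-↭ F (swap x y p)  = ≡-trans (cong (λ s → F x + (F y + s)) (sumℚ-↭ F p)) (ℚ+.x∙yz≈y∙xz (F x) (F y) _)
  sumℚ-↭ F (trans p q)   = ≡-trans (sumℚ-↭ F p) (sumℚ-↭ F q)

  unique-↭ : ∀ {xs ys : List A} → Unique xs → Unique ys →
             (∀ {x} → x ∈ xs → x ∈ ys) → (∀ {x} → x ∈ ys → x ∈ xs) → xs ↭ ys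
  unique-↭ ux uy xs⊆ys ys⊆xs = ∼bag⇒↭ (unique∧set⇒bag ux uy (mk⇔ xs⊆ys ys⊆xs))

map-unique-on : ∀ {A B : Set} (f : A → B) {xs} → Unique xs →
                (∀ {a b} → a ∈ xs → b ∈ xs → f a ≡ f b → a ≡ b) → Unique (map f xs)
map-unique-on f {[]}     []        inj = []
map-unique-on f {x ∷ xs} (x∉ ∷ u) inj =
  AllP.map⁺ (All.tabulate λ y∈ fx≡fy → All.lookup x∉ y∈ (inj (here refl) (there y∈) fx≡fy))
  ∷ map-unique-on f u (λ a∈ b∈ → inj (there a∈) (there b∈))

-- The Möbius function and q_i[Ξ_ν]

∈-oneTo⁺ : ∀ {n x} → 1 ≤ x → x ≤ n → x ∈ oneTo n
∈-oneTo⁺ {x = suc x} _ x<n = ∈P.∈-applyUpTo⁺ suc x<n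

∈-oneTo⁻ : ∀ {n x} → x ∈ oneTo n → 1 ≤ x × x ≤ n
∈-oneTo⁻ x∈ with _ , i<n , refl ← ∈P.∈-applyUpTo⁻ suc x∈ = s≤s z≤n , i<n

oneTo-unique : ∀ n → Unique (oneTo n)
oneTo-unique n = UniqueP.applyUpTo⁺₁ suc n (λ i<j _ eq → ℕP.<⇒≢ i<j (ℕP.suc-injective eq))

∣-positive : ∀ {a c} → 1 ≤ c → a ∣ c → 1 ≤ a
∣-positive {zero}  {suc c} _ 0∣c = contradiction (0∣⇒≡0 0∣c) λ ()
∣-positive {suc a}         _ _   = s≤s z≤n

∣⇒≤-positive : ∀ {a c} → 1 ≤ c → a ∣ c → a ≤ c
∣⇒≤-positive {c = suc c} _ = ∣⇒≤

prime⇒2≤ : ∀ {p} → Prime p → 2 ≤ p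
prime⇒2≤ {p} pr = ℕ.nonTrivial⇒n>1 p {{prime⇒nonTrivial pr}}

prime∣⇒≡ : ∀ {p d} → Prime p → d ∣ p → d ≢ 1 → d ≡ p
prime∣⇒≡ pr d∣p d≢1 with prime⇒irreducible pr d∣p
... | inj₁ d≡1 = contradiction d≡1 d≢1
... | inj₂ d≡p = d≡p

∃-prime-divisor : ∀ n → 2 ≤ n → ∃[ p ] (Prime p × p ∣ n)
∃-prime-divisor = <-rec _ go
  where
  go : ∀ n → (∀ {m} → m < n → 2 ≤ m → ∃[ p ] (Prime p × p ∣ m)) → 2 ≤ n → ∃[ p ] (Prime p × p ∣ n)
  go n rec 2≤n with prime? n
  ... | yes pr = n , pr , ∣-refl
  ... | no ¬pr with ¬prime⇒composite {n} {{ℕ.n>1⇒nonTrivial 2≤n}} ¬pr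
  ...   | hasNonTrivialDivisor {d} d<n d∣n =
    let p , pr , p∣d = rec d<n (ℕ.nonTrivial⇒n>1 d) in p , pr , ∣-trans p∣d d∣n

SquareFree : ℕ → Set
SquareFree n = ∀ d → 2 ≤ d → ¬ (d ℕ.* d ∣ n)

-- squarefree n only tests the candidates 2 ≤ d ≤ n, which suffices since d ≤ d * d ≤ n.
squarefree⇔SquareFree : ∀ n → 1 ≤ n → T (squarefree n) ⇔ SquareFree n
squarefree⇔SquareFree n@(suc n-1) _ = mk⇔ sound complete
  where
  test : ℕ → Bool
  test d = not ⌊ (d ℕ.* d) ∣? n ⌋
  candidates = applyUpTo (2 ℕ.+_) n-1
  sound : T (squarefree n) → SquareFree n
  sound t d@(suc (suc d-2)) _ dd∣n =
    toWitnessFalse (All.lookup (AllP.all⁺ test candidates t) (∈P.∈-applyUpTo⁺ (2 ℕ.+_) d-2<n-1)) dd∣n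
    where
    d-2<n-1 : d-2 < n-1
    d-2<n-1 = ℕP.≤-pred (ℕP.≤-trans (ℕP.m≤m*n d d) (∣⇒≤ dd∣n))
  sound _ 1 (s≤s ()) _
  complete : SquareFree n → T (squarefree n)
  complete sf = AllP.all⁻ test {xs = candidates} (All.tabulate λ d∈ →
    let _ , _ , d≡2+i = ∈P.∈-applyUpTo⁻ (2 ℕ.+_) d∈ in
    fromWitnessFalse (sf _ (ℕP.≤-trans (s≤s (s≤s z≤n)) (ℕP.≤-reflexive (sym d≡2+i)))))

T-⇔⇒≡ : ∀ {x y} → (T x → T y) → (T y → T x) → x ≡ y
T-⇔⇒≡ {false} {false} _ _ = refl
T-⇔⇒≡ {false} {true}  _ g = contradiction (g tt) λ ()
T-⇔⇒≡ {true}  {false} f _ = contradiction (f tt) λ ()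
T-⇔⇒≡ {true}  {true}  _ _ = refl

square∣p*a⇒square∣a : ∀ {p a d} → Prime p → ¬ p ∣ a → d ℕ.* d ∣ p ℕ.* a → d ℕ.* d ∣ a
square∣p*a⇒square∣a {p} {a} {d} pr p∤a dd∣pa with p ∣? d
... | no p∤d = coprime-divisor (coprime-sym p⊥dd) dd∣pa
  where
  p⊥dd : Coprime p (d ℕ.* d)
  p⊥dd {i} (i∣p , i∣dd) with prime⇒irreducible pr i∣p
  ... | inj₁ i≡1    = i≡1
  ... | inj₂ refl   with euclidsLemma d d pr i∣dd
  ...   | inj₁ p∣d = contradiction p∣d p∤d
  ...   | inj₂ p∣d = contradiction p∣d p∤d
... | yes (divides t refl) = contradiction p∣a p∤a
  where
  instance _ = prime⇒nonZero pr
  regroup : ∀ t p → t ℕ.* p ℕ.* (t ℕ.* p) ≡ p ℕ.* (t ℕ.* (t ℕ.* p))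
  regroup = solve-∀
  p∣a : p ∣ a
  p∣a = ∣-trans (∣n⇒∣m*n t (n∣m*n t)) (*-cancelˡ-∣ p (subst (_∣ p ℕ.* a) (regroup t p) dd∣pa))

squarefree-*-prime : ∀ {p a} → Prime p → ¬ p ∣ a → 1 ≤ a → squarefree (p ℕ.* a) ≡ squarefree a
squarefree-*-prime {p} {a} pr p∤a 1≤a = T-⇔⇒≡
  (from a-sf ∘ (λ sf d 2≤d dd∣a → sf d 2≤d (∣n⇒∣m*n p dd∣a)) ∘ to pa-sf)
  (from pa-sf ∘ (λ sf d 2≤d dd∣pa → sf d 2≤d (square∣p*a⇒square∣a {d = d} pr p∤a dd∣pa)) ∘ to a-sf)
  where
  open Equivalence
  1≤pa = ℕP.≤-trans 1≤a (ℕP.m≤n*m a p {{prime⇒nonZero pr}})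
  pa-sf = squarefree⇔SquareFree (p ℕ.* a) 1≤pa
  a-sf  = squarefree⇔SquareFree a 1≤a

mob-nonSquarefree : ∀ {n} d → 1 ≤ n → 2 ≤ d → d ℕ.* d ∣ n → mob n ≡ ℤ.+ 0
mob-nonSquarefree {n} d 1≤n 2≤d dd∣n with squarefree n in eq
... | true  = contradiction dd∣n (Equivalence.to (squarefree⇔SquareFree n 1≤n) (subst T (sym eq) tt) d 2≤d)
... | false = refl

primeDivisors : ℕ → List ℕ
primeDivisors n = filter (λ q → prime? q ×-dec q ∣? n) (oneTo n)

primeDivisors-*-prime : ∀ {p a} → Prime p → ¬ p ∣ a → 1 ≤ a → primeDivisors (p ℕ.* a) ↭ p ∷ primeDivisors a
primeDivisors-*-prime {p} {a} pr p∤a 1≤a = unique-↭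
  (UniqueP.filter⁺ P? (oneTo-unique (p ℕ.* a)))
  (AllP.¬Any⇒All¬ _ p∉ ∷ UniqueP.filter⁺ P?ₐ (oneTo-unique a))
  ⊆ ⊇
  where
  instance _ = prime⇒nonZero pr
  P?  = λ q → prime? q ×-dec q ∣? p ℕ.* a
  P?ₐ = λ q → prime? q ×-dec q ∣? a
  p∉ : p ∉ primeDivisors a
  p∉ p∈ = p∤a (proj₂ (proj₂ (∈P.∈-filter⁻ P?ₐ {xs = oneTo a} p∈)))
  ⊆ : ∀ {q} → q ∈ primeDivisors (p ℕ.* a) → q ∈ p ∷ primeDivisors a
  ⊆ q∈ with ∈P.∈-filter⁻ P? {xs = oneTo (p ℕ.* a)} q∈
  ... | q∈oneTo , qpr , q∣pa with euclidsLemma p a qpr q∣pa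
  ...   | inj₁ q∣p = here (prime∣⇒≡ pr q∣p λ { refl → ¬prime[1] qpr })
  ...   | inj₂ q∣a = there (∈P.∈-filter⁺ P?ₐ {xs = oneTo a} (∈-oneTo⁺ (proj₁ (∈-oneTo⁻ q∈oneTo)) (∣⇒≤-positive 1≤a q∣a)) (qpr , q∣a))
  ⊇ : ∀ {q} → q ∈ p ∷ primeDivisors a → q ∈ primeDivisors (p ℕ.* a)
  ⊇ (here refl) = ∈P.∈-filter⁺ P? {xs = oneTo (p ℕ.* a)}
    (∈-oneTo⁺ (ℕP.≤-trans (s≤s z≤n) (prime⇒2≤ pr)) (ℕP.m≤m*n p a {{ℕ.>-nonZero 1≤a}})) (pr , m∣m*n a)
  ⊇ (there q∈) with ∈P.∈-filter⁻ P?ₐ {xs = oneTo a} q∈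
  ... | q∈oneTo , qpr , q∣a =
    ∈P.∈-filter⁺ P? {xs = oneTo (p ℕ.* a)}
      (∈-oneTo⁺ (proj₁ (∈-oneTo⁻ q∈oneTo)) (ℕP.≤-trans (∣⇒≤-positive 1≤a q∣a) (ℕP.m≤n*m a p))) (qpr , ∣n⇒∣m*n p q∣a)

mob-*-prime : ∀ {p a} → Prime p → ¬ p ∣ a → 1 ≤ a → mob (p ℕ.* a) ≡ ℤ.- mob a
mob-*-prime {p} {a} pr p∤a 1≤a = ≡-trans
  (cong₂ (λ sf k → if sf then signℤ k else ℤ.+ 0) (squarefree-*-prime pr p∤a 1≤a) (↭-length (primeDivisors-*-prime pr p∤a 1≤a)))
  (flip (squarefree a))
  where
  flip : ∀ sf → (if sf then signℤ (suc (numPrimeDivisors a)) else ℤ.+ 0) ≡ ℤ.- (if sf then signℤ (numPrimeDivisors a) else ℤ.+ 0)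
  flip true  = refl
  flip false = refl

mobℚ : ℕ → ℚ
mobℚ n = fromℤ (mob n)

kronecker : ℕ → ℕ → ℚ
kronecker x y = if ⌊ x ℕ.≟ y ⌋ then 1ℚ else 0ℚ

kronecker-refl : ∀ x → kronecker x x ≡ 1ℚ
kronecker-refl x = if-⌊yes⌋ (x ℕ.≟ x) refl

kronecker-≢ : ∀ {x y} → x ≢ y → kronecker x y ≡ 0ℚ
kronecker-≢ {x} {y} = if-⌊no⌋ (x ℕ.≟ y)

divisors : ℕ → List ℕ
divisors c = filter (_∣? c) (oneTo c)

∈-divisors⁺ : ∀ {c d} → 1 ≤ c → d ∣ c → d ∈ divisors c
∈-divisors⁺ {c} 1≤c d∣c =
  ∈P.∈-filter⁺ (_∣? c) {xs = oneTo c} (∈-oneTo⁺ (∣-positive 1≤c d∣c) (∣⇒≤-positive 1≤c d∣c)) d∣c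

∈-divisors⁻ : ∀ {c d} → d ∈ divisors c → 1 ≤ d × d ∣ c
∈-divisors⁻ {c} d∈ = let d∈oneTo , d∣c = ∈P.∈-filter⁻ (_∣? c) {xs = oneTo c} d∈ in proj₁ (∈-oneTo⁻ d∈oneTo) , d∣c

divisors-unique : ∀ c → Unique (divisors c)
divisors-unique c = UniqueP.filter⁺ (_∣? c) (oneTo-unique c)

-- For a prime p ∣ c, the divisors d of c with p ∤ d cancel against their multiples p d in Σ_{d ∣ c} mob d,
-- since mob (p d) = - mob d, and the remaining divisors are divisible by p², so not squarefree.
module DivisorSplit {p c} (pr : Prime p) (p∣c : p ∣ c) (1≤c : 1 ≤ c) where

  instance _ = prime⇒nonZero pr

  coprimeDivisors squareDivisors : List ℕ
  coprimeDivisors = filter (λ d → ¬? (p ∣? d)) (divisors c)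
  squareDivisors  = filter (λ d → (p ℕ.* p) ∣? d) (divisors c)

  private
    ∈-coprime⁻ : ∀ {d} → d ∈ coprimeDivisors → d ∈ divisors c × ¬ p ∣ d
    ∈-coprime⁻ = ∈P.∈-filter⁻ (λ d → ¬? (p ∣? d)) {xs = divisors c}

    ∈-square⁻ : ∀ {d} → d ∈ squareDivisors → d ∈ divisors c × p ℕ.* p ∣ d
    ∈-square⁻ = ∈P.∈-filter⁻ (λ d → (p ℕ.* p) ∣? d) {xs = divisors c}

    split-unique : Unique (coprimeDivisors ++ map (p ℕ.*_) coprimeDivisors ++ squareDivisors)
    split-unique = UniqueP.++⁺ unique-coprime (UniqueP.++⁺ (UniqueP.map⁺ (ℕP.*-cancelˡ-≡ _ _ p) unique-coprime) unique-square disjoint₁) disjoint₂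
      where
      unique-coprime = UniqueP.filter⁺ (λ d → ¬? (p ∣? d)) (divisors-unique c)
      unique-square  = UniqueP.filter⁺ (λ d → (p ℕ.* p) ∣? d) (divisors-unique c)
      disjoint₁ : ∀ {v} → ¬ (v ∈ map (p ℕ.*_) coprimeDivisors × v ∈ squareDivisors)
      disjoint₁ (v∈ , v∈sq) with ∈P.∈-map⁻ (p ℕ.*_) v∈
      ... | a , a∈ , refl = proj₂ (∈-coprime⁻ a∈) (*-cancelˡ-∣ p (proj₂ (∈-square⁻ v∈sq)))
      disjoint₂ : ∀ {v} → ¬ (v ∈ coprimeDivisors × v ∈ map (p ℕ.*_) coprimeDivisors ++ squareDivisors)
      disjoint₂ (v∈ , v∈′) with ∈P.∈-++⁻ (map (p ℕ.*_) coprimeDivisors) v∈′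
      ... | inj₂ v∈sq = proj₂ (∈-coprime⁻ v∈) (∣-trans (m∣m*n p) (proj₂ (∈-square⁻ v∈sq)))
      ... | inj₁ v∈pA with ∈P.∈-map⁻ (p ℕ.*_) v∈pA
      ...   | a , _ , refl = proj₂ (∈-coprime⁻ v∈) (m∣m*n a)

    ⊆-split : ∀ {d} → d ∈ divisors c → d ∈ coprimeDivisors ++ map (p ℕ.*_) coprimeDivisors ++ squareDivisors
    ⊆-split {d} d∈ with p ∣? d
    ... | no p∤d = ∈P.∈-++⁺ˡ (∈P.∈-filter⁺ (λ d → ¬? (p ∣? d)) {xs = divisors c} d∈ p∤d)
    ... | yes (divides t refl) with p ∣? t
    ...   | yes p∣t = ∈P.∈-++⁺ʳ coprimeDivisors (∈P.∈-++⁺ʳ (map (p ℕ.*_) coprimeDivisors)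
              (∈P.∈-filter⁺ (λ d → (p ℕ.* p) ∣? d) {xs = divisors c} d∈ (subst (p ℕ.* p ∣_) (ℕP.*-comm p t) (*-monoʳ-∣ p p∣t))))
    ...   | no p∤t = ∈P.∈-++⁺ʳ coprimeDivisors (∈P.∈-++⁺ˡ (subst (_∈ map (p ℕ.*_) coprimeDivisors) (ℕP.*-comm p t)
              (∈P.∈-map⁺ (p ℕ.*_) (∈P.∈-filter⁺ (λ d → ¬? (p ∣? d)) {xs = divisors c} (∈-divisors⁺ 1≤c t∣c) p∤t))))
      where
      t∣c : t ∣ c
      t∣c = ∣-trans (m∣m*n p) (proj₂ (∈-divisors⁻ {c} d∈))

    ⊇-split : ∀ {d} → d ∈ coprimeDivisors ++ map (p ℕ.*_) coprimeDivisors ++ squareDivisors → d ∈ divisors c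
    ⊇-split d∈ with ∈P.∈-++⁻ coprimeDivisors d∈
    ... | inj₁ d∈A = proj₁ (∈-coprime⁻ d∈A)
    ... | inj₂ d∈′ with ∈P.∈-++⁻ (map (p ℕ.*_) coprimeDivisors) d∈′
    ...   | inj₂ d∈B = proj₁ (∈-square⁻ d∈B)
    ...   | inj₁ d∈pA with ∈P.∈-map⁻ (p ℕ.*_) d∈pA
    ...     | a , a∈A , refl with ∈-coprime⁻ a∈A
    ...       | a∈ , p∤a with ∈-divisors⁻ {c} a∈
    -- As p ∤ a, Euclid's lemma puts p into the cofactor s of a in c, whence p * a ∣ c.
    ...         | _ , divides s c≡s*a with euclidsLemma s a pr (subst (p ∣_) c≡s*a p∣c)
    ...           | inj₂ p∣a = contradiction p∣a p∤a
    ...           | inj₁ (divides r refl) = ∈-divisors⁺ 1≤c (divides r (≡-trans c≡s*a (ℕP.*-assoc r p a)))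

  divisors-split : divisors c ↭ coprimeDivisors ++ map (p ℕ.*_) coprimeDivisors ++ squareDivisors
  divisors-split = unique-↭ (divisors-unique c) split-unique ⊆-split ⊇-split

  ∑-mob-coprimeMultiples : sumℚ (map mobℚ (map (p ℕ.*_) coprimeDivisors)) ≡ - sumℚ (map mobℚ coprimeDivisors)
  ∑-mob-coprimeMultiples = begin
    sumℚ (map mobℚ (map (p ℕ.*_) coprimeDivisors))   ≡⟨ cong sumℚ (LP.map-∘ coprimeDivisors) ⟨
    sumℚ (map (λ a → mobℚ (p ℕ.* a)) coprimeDivisors) ≡⟨ sumℚ-cong coprimeDivisors mob-p* ⟩
    sumℚ (map (λ a → - mobℚ a) coprimeDivisors)       ≡⟨ sumℚ-neg mobℚ coprimeDivisors ⟩
    - sumℚ (map mobℚ coprimeDivisors)                 ∎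
    where
    open ≡-Reasoning
    mob-p* : ∀ {a} → a ∈ coprimeDivisors → mobℚ (p ℕ.* a) ≡ - mobℚ a
    mob-p* {a} a∈ = let a∈D , p∤a = ∈-coprime⁻ a∈ in
      ≡-trans (cong fromℤ (mob-*-prime pr p∤a (proj₁ (∈-divisors⁻ {c} a∈D)))) (fromℤ-homo‿- (mob a))

  ∑-mob-squareDivisors : sumℚ (map mobℚ squareDivisors) ≡ 0ℚ
  ∑-mob-squareDivisors = sumℚ-zero mobℚ squareDivisors λ b∈ →
    let b∈D , pp∣b = ∈-square⁻ b∈ in cong fromℤ (mob-nonSquarefree p (proj₁ (∈-divisors⁻ {c} b∈D)) (prime⇒2≤ pr) pp∣b)

∑-divisors-mob : ∀ c → 1 ≤ c → sumℚ (map mobℚ (divisors c)) ≡ kronecker c 1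
∑-divisors-mob 1 _ = refl
∑-divisors-mob c@(suc (suc _)) 1≤c = begin
  sumℚ (map mobℚ (divisors c))                        ≡⟨ sumℚ-↭ mobℚ divisors-split ⟩
  sumℚ (map mobℚ (A ++ map (p ℕ.*_) A ++ B))          ≡⟨ sumℚ-++ mobℚ A _ ⟩
  ΣA + sumℚ (map mobℚ (map (p ℕ.*_) A ++ B))          ≡⟨ cong (ΣA +_) (sumℚ-++ mobℚ (map (p ℕ.*_) A) B) ⟩
  ΣA + (sumℚ (map mobℚ (map (p ℕ.*_) A)) + sumℚ (map mobℚ B))
                                                      ≡⟨ cong₂ (λ x y → ΣA + (x + y)) ∑-mob-coprimeMultiples ∑-mob-squareDivisors ⟩
  ΣA + (- ΣA + 0ℚ)                                    ≡⟨ cong (ΣA +_) (ℚP.+-identityʳ (- ΣA)) ⟩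
  ΣA - ΣA                                             ≡⟨ ℚP.+-inverseʳ ΣA ⟩
  0ℚ                                                  ∎
  where
  open ≡-Reasoning
  prime-divisor = ∃-prime-divisor c (s≤s (s≤s z≤n))
  p = proj₁ prime-divisor
  open DivisorSplit (proj₁ (proj₂ prime-divisor)) (proj₂ (proj₂ prime-divisor)) 1≤c
  A = coprimeDivisors
  B = squareDivisors
  ΣA = sumℚ (map mobℚ A)

kronecker-cofactor : ∀ c x → 1 ≤ c → 1 ≤ x → kronecker c 1 ≡ kronecker x (c ℕ.* x)
kronecker-cofactor 1                x _ _   =
  sym (≡-trans (cong (kronecker x) (ℕP.*-identityˡ x)) (kronecker-refl x))
kronecker-cofactor c@(suc (suc _)) x _ 1≤x =
  sym (kronecker-≢ (ℕP.<⇒≢ (subst (x <_) (ℕP.*-comm x c) (ℕP.m<m*n x c {{ℕ.>-nonZero 1≤x}} (s≤s (s≤s z≤n))))))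

multiplesDividing : ℕ → ℕ → List ℕ
multiplesDividing x N = filter (λ d → suc d ∣? N ×-dec x ∣? suc d) (upTo N)

cofactors-unique : ∀ x N → 1 ≤ N → Unique (map (λ d → N / suc d) (multiplesDividing x N))
cofactors-unique x N 1≤N = map-unique-on (λ d → N / suc d) (UniqueP.filter⁺ P? (UniqueP.upTo⁺ N)) inj
  where
  P? = λ d → suc d ∣? N ×-dec x ∣? suc d
  inj : ∀ {a b} → a ∈ multiplesDividing x N → b ∈ multiplesDividing x N → N / suc a ≡ N / suc b → a ≡ b
  inj {a} {b} a∈ b∈ eq with proj₂ (∈P.∈-filter⁻ P? {xs = upTo N} a∈) | proj₂ (∈P.∈-filter⁻ P? {xs = upTo N} b∈)
  ... | divides qa N≡qa*a , _ | divides qb N≡qb*b , _ =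
    let qa≡qb = ≡-trans (sym (n/m≡quotient (divides qa N≡qa*a))) (≡-trans eq (n/m≡quotient (divides qb N≡qb*b)))
        1≤qa  = ∣-positive 1≤N (divides (suc a) (≡-trans N≡qa*a (ℕP.*-comm qa (suc a))))
    in ℕP.suc-injective (ℕP.*-cancelˡ-≡ (suc a) (suc b) qa {{ℕ.>-nonZero 1≤qa}}
         (≡-trans (sym N≡qa*a) (≡-trans N≡qb*b (cong (ℕ._* suc b) (sym qa≡qb)))))

cofactors↭divisors : ∀ x N c → 1 ≤ x → 1 ≤ N → N ≡ c ℕ.* x →
  map (λ d → N / suc d) (multiplesDividing x N) ↭ divisors c
cofactors↭divisors x N c 1≤x 1≤N N≡c*x = unique-↭ (cofactors-unique x N 1≤N) (divisors-unique c) ⊆ ⊇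
  where
  open ≡-Reasoning
  P? = λ d → suc d ∣? N ×-dec x ∣? suc d
  L = multiplesDividing x N
  cofactor : ℕ → ℕ
  cofactor d = N / suc d
  1≤c : 1 ≤ c
  1≤c = ∣-positive 1≤N (divides x (≡-trans N≡c*x (ℕP.*-comm c x)))
  ∈L⁻ : ∀ {d} → d ∈ L → suc d ∣ N × x ∣ suc d
  ∈L⁻ d∈ = proj₂ (∈P.∈-filter⁻ P? {xs = upTo N} d∈)
  ⊆ : ∀ {z} → z ∈ map cofactor L → z ∈ divisors c
  ⊆ z∈ with ∈P.∈-map⁻ cofactor z∈
  ... | d , d∈ , refl with ∈L⁻ d∈
  ... | divides q N≡q*e , divides t e≡t*x =
    subst (_∈ divisors c) (sym (n/m≡quotient (divides q N≡q*e)))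
    (∈-divisors⁺ 1≤c (divides t (ℕP.*-cancelʳ-≡ c (t ℕ.* q) x {{ℕ.>-nonZero 1≤x}} (begin
      c ℕ.* x         ≡⟨ N≡c*x ⟨
      N               ≡⟨ N≡q*e ⟩
      q ℕ.* suc d     ≡⟨ cong (q ℕ.*_) e≡t*x ⟩
      q ℕ.* (t ℕ.* x) ≡⟨ regroup q t x ⟩
      t ℕ.* q ℕ.* x   ∎))))
    where
    regroup : ∀ q t x → q ℕ.* (t ℕ.* x) ≡ t ℕ.* q ℕ.* x
    regroup = solve-∀
  ⊇ : ∀ {z} → z ∈ divisors c → z ∈ map cofactor L
  ⊇ {z} z∈ with ∈-divisors⁻ {c} z∈
  ... | _ , divides t c≡t*z = hit (t ℕ.* x) e≥1 N≡z*e (n∣m*n t)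
    where
    regroup : ∀ t z x → t ℕ.* z ℕ.* x ≡ z ℕ.* (t ℕ.* x)
    regroup = solve-∀
    N≡z*e : N ≡ z ℕ.* (t ℕ.* x)
    N≡z*e = ≡-trans N≡c*x (≡-trans (cong (ℕ._* x) c≡t*z) (regroup t z x))
    e≥1 = ∣-positive 1≤N (divides z N≡z*e)
    hit : ∀ e → 1 ≤ e → N ≡ z ℕ.* e → x ∣ e → z ∈ map cofactor L
    hit (suc d) _ N≡z*e x∣e = subst (_∈ map cofactor L) (n/m≡quotient (divides z N≡z*e))
      (∈P.∈-map⁺ cofactor (∈P.∈-filter⁺ P? {xs = upTo N}
        (∈P.∈-upTo⁺ (∣⇒≤-positive 1≤N (divides z N≡z*e))) (divides z N≡z*e , x∣e)))

∑-mob-multiplesDividing : ∀ x N → 1 ≤ x → 1 ≤ N →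
  sumℚ (map (λ d → mobℚ (N / suc d)) (multiplesDividing x N)) ≡ kronecker x N
∑-mob-multiplesDividing x N 1≤x 1≤N with x ∣? N
... | no x∤N = ≡-trans
  (sumℚ-zero _ (multiplesDividing x N) λ d∈ →
    let _ , d∣N , x∣d = ∈P.∈-filter⁻ (λ d → suc d ∣? N ×-dec x ∣? suc d) {xs = upTo N} d∈ in contradiction (∣-trans x∣d d∣N) x∤N)
  (sym (kronecker-≢ λ { refl → x∤N ∣-refl }))
... | yes (divides c N≡c*x) = begin
  sumℚ (map (mobℚ ∘ cofactor) L)       ≡⟨ cong sumℚ (LP.map-∘ L) ⟩
  sumℚ (map mobℚ (map cofactor L))     ≡⟨ sumℚ-↭ mobℚ (cofactors↭divisors x N c 1≤x 1≤N N≡c*x) ⟩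
  sumℚ (map mobℚ (divisors c))         ≡⟨ ∑-divisors-mob c 1≤c ⟩
  kronecker c 1                        ≡⟨ kronecker-cofactor c x 1≤c 1≤x ⟩
  kronecker x (c ℕ.* x)                ≡⟨ cong (kronecker x) N≡c*x ⟨
  kronecker x N                        ∎
  where
  open ≡-Reasoning
  L = multiplesDividing x N
  cofactor : ℕ → ℕ
  cofactor d = N / suc d
  1≤c : 1 ≤ c
  1≤c = ∣-positive 1≤N (divides x (≡-trans N≡c*x (ℕP.*-comm c x)))

qTerm : ℕ → List ℕ → ℕ → ℚ
qTerm N ν d = if ⌊ suc d ∣? N ⌋ then mobℚ (N / suc d) * pAt ν (suc d) else 0ℚ

qTerm-∷ : ∀ N a ν d → qTerm N (a ∷ ν) d ≡
  fromℕ a * (if ⌊ suc d ∣? N ×-dec a ∣? suc d ⌋ then mobℚ (N / suc d) else 0ℚ) + qTerm N ν d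
qTerm-∷ N a ν d = ≡-trans
  (cong (λ s → if ⌊ suc d ∣? N ⌋ then μ * s else 0ℚ) (fromℕ-homo-+ (if ⌊ a ∣? suc d ⌋ then a else 0) _))
  (split (suc d ∣? N) (a ∣? suc d))
  where
  μ = mobℚ (N / suc d)
  r = pAt ν (suc d)
  split : ∀ {P Q : Set} (P? : Dec P) (Q? : Dec Q) →
    (if ⌊ P? ⌋ then μ * (fromℕ (if ⌊ Q? ⌋ then a else 0) + r) else 0ℚ) ≡
    fromℕ a * (if ⌊ P? ×-dec Q? ⌋ then μ else 0ℚ) + (if ⌊ P? ⌋ then μ * r else 0ℚ)
  split (yes _) (yes _) = solve 3 (λ μ a r → μ :* (a :+ r) := a :* μ :+ μ :* r) refl μ (fromℕ a) r
  split (yes _) (no _)  = solve 3 (λ μ a r → μ :* (con 0ℚ :+ r) := a :* con 0ℚ :+ μ :* r) refl μ (fromℕ a) r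
  split (no _)  _       = solve 1 (λ a → con 0ℚ := a :* con 0ℚ :+ con 0ℚ) refl (fromℕ a)

mult-∷ : ∀ N a ν → fromℕ (mult N (a ∷ ν)) ≡ kronecker a N + fromℕ (mult N ν)
mult-∷ N a ν = cases (a ℕ.≟ N)
  where
  cases : Dec (a ≡ N) → fromℕ (mult N (a ∷ ν)) ≡ kronecker a N + fromℕ (mult N ν)
  cases (yes refl) = ≡-trans (cong (fromℕ ∘ length) (LP.filter-accept (ℕ._≟ a) {x = a} {xs = ν} refl))
                             (≡-trans (fromℕ-suc (mult a ν)) (cong (_+ fromℕ (mult a ν)) (sym (kronecker-refl a))))
  cases (no  a≢N)  = ≡-trans (cong (fromℕ ∘ length) (LP.filter-reject (ℕ._≟ N) {x = a} {xs = ν} a≢N))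
                             (≡-trans (sym (ℚP.+-identityˡ (fromℕ (mult N ν)))) (cong (_+ fromℕ (mult N ν)) (sym (kronecker-≢ a≢N))))

fromℕ-*-kronecker : ∀ a N → fromℕ a * kronecker a N ≡ fromℕ N * kronecker a N
fromℕ-*-kronecker a N with a ℕ.≟ N
... | yes refl = refl
... | no  _    = ≡-trans (ℚP.*-zeroʳ (fromℕ a)) (sym (ℚP.*-zeroʳ (fromℕ N)))

∑-qTerm : ∀ N ν → 1 ≤ N → All (0 <_) ν → sumℚ (map (qTerm N ν) (upTo N)) ≡ fromℕ N * fromℕ (mult N ν)
∑-qTerm N [] _ [] = ≡-trans (sumℚ-zero (qTerm N []) (upTo N) (λ {d} _ → qTerm-[] d)) (sym (ℚP.*-zeroʳ (fromℕ N)))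
  where
  qTerm-[] : ∀ d → qTerm N [] d ≡ 0ℚ
  qTerm-[] d with suc d ∣? N
  ... | yes _ = ℚP.*-zeroʳ (mobℚ (N / suc d))
  ... | no  _ = refl
∑-qTerm N (a ∷ ν) 1≤N (0<a ∷ pos) = begin
  sumℚ (map (qTerm N (a ∷ ν)) ds)                                        ≡⟨ sumℚ-cong ds (λ {d} _ → qTerm-∷ N a ν d) ⟩
  sumℚ (map (λ d → fromℕ a * δ d + qTerm N ν d) ds)                      ≡⟨ sumℚ-distrib-+ _ (qTerm N ν) ds ⟩
  sumℚ (map (λ d → fromℕ a * δ d) ds) + sumℚ (map (qTerm N ν) ds)        ≡⟨ cong (_+ sumℚ (map (qTerm N ν) ds)) (sumℚ-distribˡ (fromℕ a) δ ds) ⟩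
  fromℕ a * sumℚ (map δ ds) + sumℚ (map (qTerm N ν) ds)                  ≡⟨ cong₂ (λ x y → fromℕ a * x + y) ∑δ (∑-qTerm N ν 1≤N pos) ⟩
  fromℕ a * kronecker a N + fromℕ N * fromℕ (mult N ν)                   ≡⟨ cong (_+ fromℕ N * fromℕ (mult N ν)) (fromℕ-*-kronecker a N) ⟩
  fromℕ N * kronecker a N + fromℕ N * fromℕ (mult N ν)                   ≡⟨ ℚP.*-distribˡ-+ (fromℕ N) _ _ ⟨
  fromℕ N * (kronecker a N + fromℕ (mult N ν))                           ≡⟨ cong (fromℕ N *_) (mult-∷ N a ν) ⟨
  fromℕ N * fromℕ (mult N (a ∷ ν))                                       ∎
  where
  open ≡-Reasoning
  ds = upTo N
  δ : ℕ → ℚ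
  δ d = if ⌊ suc d ∣? N ×-dec a ∣? suc d ⌋ then mobℚ (N / suc d) else 0ℚ
  ∑δ : sumℚ (map δ ds) ≡ kronecker a N
  ∑δ = ≡-trans (sumℚ-filter (λ d → suc d ∣? N ×-dec a ∣? suc d) (λ d → mobℚ (N / suc d)) ds)
               (∑-mob-multiplesDividing a N 0<a 1≤N)

-- Möbius inversion of p_d[Ξ_ν] = Σ_{e ∣ d} e m_e(ν).
qAt≡mult : ∀ i ν → All (0 <_) ν → qAt ν (suc i) ≡ fromℕ (mult (suc i) ν)
qAt≡mult i ν pos = ≡-trans (cong (recip (suc i) *_) (∑-qTerm (suc i) ν (s≤s z≤n) pos))
                           (recip-*-fromℕ-* i (fromℕ (mult (suc i) ν)))

-- Charlier polynomials

charlierTerm : ℕ → ℕ → ℚ → ℕ → ℚ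
charlierTerm i r x k = signℚ (r ∸ k) * fromℕ (r C k) * (fromℕ (i ℕ.^ k) * falling x k)

-- p_{i^r}[Ξ_ν] = charlier i r (q_i[Ξ_ν]); up to the factor i^r this is the Charlier polynomial of parameter 1/i.
charlier : ℕ → ℕ → ℚ → ℚ
charlier i r x = sumℚ (map (charlierTerm i r x) (upTo (suc r)))

charlier-0 : ∀ i x → charlier i 0 x ≡ 1ℚ
charlier-0 i x = refl

charlier-∑ : ∀ i r x → charlier i r x ≡ ∑ (charlierTerm i r x) (suc r)
charlier-∑ i r x = sumℚ-applyUpTo (charlierTerm i r x) id (suc r)

falling-suc : ∀ x k → falling x (suc k) ≡ x * falling (x - 1ℚ) k
falling-suc x zero    = solve 1 (λ x → con 1ℚ :* (x :- con 0ℚ) := x :* con 1ℚ) refl x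
falling-suc x (suc k) = begin
  falling x (suc k) * (x - fromℕ (suc k))
    ≡⟨ cong₂ (λ a b → a * (x - b)) (falling-suc x k) (fromℕ-suc k) ⟩
  x * falling (x - 1ℚ) k * (x - (1ℚ + fromℕ k))
    ≡⟨ solve 3 (λ x f c → x :* f :* (x :- (con 1ℚ :+ c)) := x :* (f :* ((x :- con 1ℚ) :- c))) refl x (falling (x - 1ℚ) k) (fromℕ k) ⟩
  x * (falling (x - 1ℚ) k * ((x - 1ℚ) - fromℕ k)) ∎
  where open ≡-Reasoning

charlierTerm-0 : ∀ i r x → charlierTerm i (suc r) x 0 ≡ - charlierTerm i r x 0
charlierTerm-0 i r x =
  solve 1 (λ s → (:- s) :* con 1ℚ :* (con 1ℚ :* con 1ℚ) := :- (s :* con 1ℚ :* (con 1ℚ :* con 1ℚ))) refl (signℚ r)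

charlierTerm-top : ∀ i r x → charlierTerm i r x (suc r) ≡ 0ℚ
charlierTerm-top i r x = ≡-trans (cong (λ c → signℚ (r ∸ suc r) * fromℕ c * (fromℕ (i ℕ.^ suc r) * falling x (suc r))) (k>n⇒nCk≡0 (ℕP.n<1+n r)))
  (solve 2 (λ s y → s :* con 0ℚ :* y := con 0ℚ) refl (signℚ (r ∸ suc r)) (fromℕ (i ℕ.^ suc r) * falling x (suc r)))

sign-*-C : ∀ r k → signℚ (r ∸ k) * fromℕ (r C suc k) ≡ - (signℚ (r ∸ suc k) * fromℕ (r C suc k))
sign-*-C r k = cases (k <? r)
  where
  cases : Dec (k < r) → signℚ (r ∸ k) * fromℕ (r C suc k) ≡ - (signℚ (r ∸ suc k) * fromℕ (r C suc k))
  cases (yes k<r) = ≡-trans (cong (λ s → s * fromℕ (r C suc k)) (cong signℚ (ℕP.+-∸-assoc 1 k<r)))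
                            (sym (ℚP.neg-distribˡ-* (signℚ (r ∸ suc k)) _))
  cases (no  k≮r) = begin
    signℚ (r ∸ k) * fromℕ (r C suc k)           ≡⟨ cong (λ c → signℚ (r ∸ k) * fromℕ c) C≡0 ⟩
    signℚ (r ∸ k) * 0ℚ                          ≡⟨ ℚP.*-zeroʳ (signℚ (r ∸ k)) ⟩
    0ℚ                                          ≡⟨ cong -_ (ℚP.*-zeroʳ (signℚ (r ∸ suc k))) ⟨
    - (signℚ (r ∸ suc k) * 0ℚ)                  ≡⟨ cong (λ c → - (signℚ (r ∸ suc k) * fromℕ c)) C≡0 ⟨
    - (signℚ (r ∸ suc k) * fromℕ (r C suc k))   ∎
    where
    open ≡-Reasoning
    C≡0 = k>n⇒nCk≡0 (s≤s (ℕP.≮⇒≥ k≮r))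

charlierTerm-pascal : ∀ i r x k →
  charlierTerm i (suc r) x (suc k) ≡ fromℕ i * x * charlierTerm i r (x - 1ℚ) k + - charlierTerm i r x (suc k)
charlierTerm-pascal i r x k = begin
  s * fromℕ (suc r C suc k) * (fromℕ (i ℕ.^ suc k) * falling x (suc k))
    ≡⟨ cong₂ (λ c y → s * c * y) (≡-trans (cong fromℕ (sym (nCk+nC[k+1]≡[n+1]C[k+1] r k))) (fromℕ-homo-+ (r C k) (r C suc k)))
                                 (cong₂ _*_ (fromℕ-homo-* i (i ℕ.^ k)) (falling-suc x k)) ⟩
  s * (fromℕ (r C k) + fromℕ (r C suc k)) * ((I * p) * (x * f))
    ≡⟨ solve 7 (λ s a b I p X f → s :* (a :+ b) :* ((I :* p) :* (X :* f)) := I :* X :* (s :* a :* (p :* f)) :+ s :* b :* ((I :* p) :* (X :* f))) refl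
         s (fromℕ (r C k)) (fromℕ (r C suc k)) I p x f ⟩
  I * x * charlierTerm i r (x - 1ℚ) k + s * fromℕ (r C suc k) * ((I * p) * (x * f))
    ≡⟨ cong₂ (λ c y → I * x * charlierTerm i r (x - 1ℚ) k + c * y) (sign-*-C r k)
             (sym (cong₂ _*_ (fromℕ-homo-* i (i ℕ.^ k)) (falling-suc x k))) ⟩
  I * x * charlierTerm i r (x - 1ℚ) k + - (signℚ (r ∸ suc k) * fromℕ (r C suc k)) * (fromℕ (i ℕ.^ suc k) * falling x (suc k))
    ≡⟨ cong (I * x * charlierTerm i r (x - 1ℚ) k +_)
            (ℚP.neg-distribˡ-* (signℚ (r ∸ suc k) * fromℕ (r C suc k)) (fromℕ (i ℕ.^ suc k) * falling x (suc k))) ⟨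
  I * x * charlierTerm i r (x - 1ℚ) k + - charlierTerm i r x (suc k) ∎
  where
  open ≡-Reasoning
  s = signℚ (r ∸ k)
  I = fromℕ i
  p = fromℕ (i ℕ.^ k)
  f = falling (x - 1ℚ) k

charlier-suc : ∀ i r x → charlier i (suc r) x ≡ fromℕ i * x * charlier i r (x - 1ℚ) - charlier i r x
charlier-suc i r x = begin
  charlier i (suc r) x
    ≡⟨ charlier-∑ i (suc r) x ⟩
  t′ 0 + ∑[ k < suc r ] t′ (suc k)
    ≡⟨ cong₂ _+_ (charlierTerm-0 i r x) (∑-cong (suc r) (λ k _ → charlierTerm-pascal i r x k)) ⟩
  - t 0 + ∑[ k < suc r ] (ix * charlierTerm i r (x - 1ℚ) k + - t (suc k))
    ≡⟨ cong (- t 0 +_) (≡-trans (∑-distrib-+ (λ k → ix * charlierTerm i r (x - 1ℚ) k) (λ k → - t (suc k)) (suc r))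
                                (cong₂ _+_ (∑-distribˡ ix (charlierTerm i r (x - 1ℚ)) (suc r)) (∑-neg (λ k → t (suc k)) (suc r)))) ⟩
  - t 0 + (ix * ∑ (charlierTerm i r (x - 1ℚ)) (suc r) - ∑[ k < suc r ] t (suc k))
    ≡⟨ cong₂ (λ a b → - t 0 + (ix * a - b)) (sym (charlier-∑ i r (x - 1ℚ))) tail-sum ⟩
  - t 0 + (ix * charlier i r (x - 1ℚ) - (charlier i r x - t 0))
    ≡⟨ solve 3 (λ a b c → :- a :+ (b :- (c :- a)) := b :- c) refl (t 0) (ix * charlier i r (x - 1ℚ)) (charlier i r x) ⟩
  ix * charlier i r (x - 1ℚ) - charlier i r x ∎
  where
  open ≡-Reasoning
  t′ = charlierTerm i (suc r) x
  t  = charlierTerm i r x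
  ix = fromℕ i * x
  tail-sum : ∑[ k < suc r ] t (suc k) ≡ charlier i r x - t 0
  tail-sum = begin
    ∑[ k < suc r ] t (suc k)           ≡⟨ ∑-init-last (λ k → t (suc k)) r ⟩
    ∑[ k < r ] t (suc k) + t (suc r)   ≡⟨ cong (∑[ k < r ] t (suc k) +_) (charlierTerm-top i r x) ⟩
    ∑[ k < r ] t (suc k) + 0ℚ          ≡⟨ solve 2 (λ a b → a :+ con 0ℚ := (b :+ a) :- b) refl (∑[ k < r ] t (suc k)) (t 0) ⟩
    ∑ t (suc r) - t 0                  ≡⟨ cong (_- t 0) (charlier-∑ i r x) ⟨
    charlier i r x - t 0               ∎

-- charlier-suc at r - 1, multiplied by r so that it also holds for r = 0.
charlier-pred : ∀ i r x →
  fromℕ r * (fromℕ i * x * charlier i (r ∸ 1) (x - 1ℚ) - charlier i (r ∸ 1) x) ≡ fromℕ r * charlier i r x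
charlier-pred i zero    x = ≡-trans (ℚP.*-zeroˡ (fromℕ i * x * charlier i 0 (x - 1ℚ) - charlier i 0 x)) (sym (ℚP.*-zeroˡ (charlier i 0 x)))
charlier-pred i (suc r) x = cong (fromℕ (suc r) *_) (sym (charlier-suc i r x))

charlier-shift : ∀ i r x → charlier i r (x + 1ℚ) ≡ charlier i r x + fromℕ (i ℕ.* r) * charlier i (r ∸ 1) x
charlier-shift i zero    x = begin
  charlier i 0 (x + 1ℚ)                                 ≡⟨ charlier-0 i (x + 1ℚ) ⟩
  1ℚ                                                    ≡⟨ ℚP.+-identityʳ 1ℚ ⟨
  1ℚ + 0ℚ                                               ≡⟨ cong₂ _+_ (sym (charlier-0 i x)) (sym (ℚP.*-zeroˡ (charlier i 0 x))) ⟩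
  charlier i 0 x + 0ℚ * charlier i 0 x                  ≡⟨ cong (λ z → charlier i 0 x + fromℕ z * charlier i 0 x) (ℕP.*-zeroʳ i) ⟨
  charlier i 0 x + fromℕ (i ℕ.* 0) * charlier i 0 x     ∎
  where open ≡-Reasoning
charlier-shift i (suc r) x = begin
  charlier i (suc r) (x + 1ℚ)
    ≡⟨ charlier-suc i r (x + 1ℚ) ⟩
  I * (x + 1ℚ) * charlier i r (x + 1ℚ - 1ℚ) - charlier i r (x + 1ℚ)
    ≡⟨ cong₂ (λ y z → I * (x + 1ℚ) * charlier i r y - z) (solve 1 (λ x → x :+ con 1ℚ :- con 1ℚ := x) refl x) (charlier-shift i r x) ⟩
  I * (x + 1ℚ) * a - (a + fromℕ (i ℕ.* r) * c)
    ≡⟨ cong (λ z → I * (x + 1ℚ) * a - (a + z * c)) (fromℕ-homo-* i r) ⟩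
  I * (x + 1ℚ) * a - (a + I * R * c)
    ≡⟨ solve 5 (λ I X R a c → I :* (X :+ con 1ℚ) :* a :- (a :+ I :* R :* c) := I :* X :* a :+ I :* a :- a :- I :* R :* c) refl I x R a c ⟩
  I * x * a + I * a - a - I * R * c
    ≡⟨ cong (λ z → I * x * z + I * a - a - I * R * c) a≡b+IRd ⟩
  I * x * (b + I * R * d) + I * a - a - I * R * c
    ≡⟨ solve 7 (λ I X R a b c d → I :* X :* (b :+ I :* R :* d) :+ I :* a :- a :- I :* R :* c
                                   := (I :* X :* b :- a) :+ I :* a :+ I :* (R :* (I :* X :* d :- c))) refl I x R a b c d ⟩
  (I * x * b - a) + I * a + I * (R * (I * x * d - c))
    ≡⟨ cong₂ (λ y w → y + I * a + I * w) (sym (charlier-suc i r x)) (charlier-pred i r x) ⟩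
  charlier i (suc r) x + I * a + I * (R * a)
    ≡⟨ solve 4 (λ C I R a → C :+ I :* a :+ I :* (R :* a) := C :+ I :* (con 1ℚ :+ R) :* a) refl (charlier i (suc r) x) I R a ⟩
  charlier i (suc r) x + I * (1ℚ + R) * a
    ≡⟨ cong (λ z → charlier i (suc r) x + z * a) (≡-trans (cong (I *_) (sym (fromℕ-suc r))) (sym (fromℕ-homo-* i (suc r)))) ⟩
  charlier i (suc r) x + fromℕ (i ℕ.* suc r) * a ∎
  where
  open ≡-Reasoning
  I = fromℕ i
  R = fromℕ r
  a = charlier i r x
  b = charlier i r (x - 1ℚ)
  c = charlier i (r ∸ 1) x
  d = charlier i (r ∸ 1) (x - 1ℚ)
  a≡b+IRd : a ≡ b + I * R * d
  a≡b+IRd = begin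
    charlier i r x                 ≡⟨ cong (charlier i r) (solve 1 (λ x → x := x :- con 1ℚ :+ con 1ℚ) refl x) ⟩
    charlier i r (x - 1ℚ + 1ℚ)     ≡⟨ charlier-shift i r (x - 1ℚ) ⟩
    b + fromℕ (i ℕ.* r) * d        ≡⟨ cong (λ z → b + z * d) (fromℕ-homo-* i r) ⟩
    b + I * R * d                  ∎

-- Sums over partitions

Weights : Set
Weights = ℕ → ℕ → ℚ

-- Sum over the partitions of n into parts ≤ k of ∏_{i ≤ k} w i (m_i), where m_i is the multiplicity of
-- the part i: the recursion chooses the multiplicity m of the largest part k.  Equivalently, the
-- coefficient of tⁿ in ∏_{i ≤ k} Σ_m w i m t^{i m}.
partitionSum : Weights → ℕ → ℕ → ℚ
partitionSum w zero    zero    = 1ℚ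
partitionSum w zero    (suc n) = 0ℚ
partitionSum w (suc k) n       =
  ∑[ m < suc n ] when (suc k ℕ.* m ≤? n) (w (suc k) m * partitionSum w k (n ∸ suc k ℕ.* m))

partitionSum-cong : ∀ {w w′} k → (∀ i m → i < k → w (suc i) m ≡ w′ (suc i) m) →
                    ∀ n → partitionSum w k n ≡ partitionSum w′ k n
partitionSum-cong zero    eq zero    = refl
partitionSum-cong zero    eq (suc n) = refl
partitionSum-cong {w} {w′} (suc k) eq n = ∑-cong (suc n) λ m _ → cong (when (suc k ℕ.* m ≤? n))
  (cong₂ _*_ (eq k m (ℕP.n<1+n k)) (partitionSum-cong {w} {w′} k (λ i m i<k → eq i m (ℕP.m<n⇒m<1+n i<k)) (n ∸ suc k ℕ.* m)))

AgreeExcept : ℕ → Weights → Weights → Set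
AgreeExcept i w u = ∀ j → j ≢ i → w j ≡ u j

partitionSum-agreeBelow : ∀ {w u} i k → k < i → AgreeExcept i w u → ∀ n → partitionSum w k n ≡ partitionSum u k n
partitionSum-agreeBelow i k k<i agree =
  partitionSum-cong k λ j m j<k → cong (λ f → f m) (agree (suc j) (ℕP.<⇒≢ (ℕP.≤-<-trans j<k k<i)))

∑-when-linear : ∀ {P : ℕ → Set} (P? : ∀ m → Dec (P m)) (f : ℕ → ℚ) c (g : ℕ → ℚ) n →
  ∑[ m < n ] when (P? m) (f m + c * g m) ≡ ∑[ m < n ] when (P? m) (f m) + c * ∑[ m < n ] when (P? m) (g m)
∑-when-linear P? f c g n = begin
  ∑[ m < n ] when (P? m) (f m + c * g m)                             ≡⟨ ∑-cong n (λ m _ → when-linear (P? m) (f m) c (g m)) ⟩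
  ∑[ m < n ] (when (P? m) (f m) + c * when (P? m) (g m))            ≡⟨ ∑-distrib-+ (λ m → when (P? m) (f m)) (λ m → c * when (P? m) (g m)) n ⟩
  ∑[ m < n ] when (P? m) (f m) + ∑[ m < n ] (c * when (P? m) (g m)) ≡⟨ cong (∑[ m < n ] when (P? m) (f m) +_) (∑-distribˡ c (λ m → when (P? m) (g m)) n) ⟩
  ∑[ m < n ] when (P? m) (f m) + c * ∑[ m < n ] when (P? m) (g m)   ∎
  where open ≡-Reasoning

partitionSum-linear : ∀ i {w u v} c k → 1 ≤ i → i ≤ k → AgreeExcept i w u → AgreeExcept i w v →
  (∀ m → w i m ≡ u i m + c * v i m) → ∀ n → partitionSum w k n ≡ partitionSum u k n + c * partitionSum v k n
partitionSum-linear i c zero 1≤i i≤0 = contradiction (ℕP.≤-trans 1≤i i≤0) λ ()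
partitionSum-linear i {w} {u} {v} c (suc k) 1≤i i≤1+k w≈u w≈v wᵢ n =
  ≡-trans (∑-cong (suc n) λ m _ → cong (when (suc k ℕ.* m ≤? n)) (summand m (n ∸ suc k ℕ.* m)))
          (∑-when-linear (λ m → suc k ℕ.* m ≤? n) (λ m → u (suc k) m * partitionSum u k (n ∸ suc k ℕ.* m)) c
                                                  (λ m → v (suc k) m * partitionSum v k (n ∸ suc k ℕ.* m)) (suc n))
  where
  open ≡-Reasoning
  summand : ∀ m n′ → w (suc k) m * partitionSum w k n′ ≡
                     u (suc k) m * partitionSum u k n′ + c * (v (suc k) m * partitionSum v k n′)
  summand m n′ with i ℕ.≟ suc k
  ... | yes refl = begin
    w i m * partitionSum w k n′                                  ≡⟨ cong₂ _*_ (wᵢ m) (partitionSum-agreeBelow i k ℕP.≤-refl w≈u n′) ⟩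
    (u i m + c * v i m) * partitionSum u k n′                    ≡⟨ solve 4 (λ a c b t → (a :+ c :* b) :* t := a :* t :+ c :* (b :* t)) refl (u i m) c (v i m) _ ⟩
    u i m * partitionSum u k n′ + c * (v i m * partitionSum u k n′) ≡⟨ cong (λ t → u i m * partitionSum u k n′ + c * (v i m * t)) u≈v ⟩
    u i m * partitionSum u k n′ + c * (v i m * partitionSum v k n′) ∎
    where
    u≈v = ≡-trans (sym (partitionSum-agreeBelow i k ℕP.≤-refl w≈u n′)) (partitionSum-agreeBelow i k ℕP.≤-refl w≈v n′)
  ... | no i≢1+k = begin
    w (suc k) m * partitionSum w k n′
      ≡⟨ cong₂ _*_ (cong (λ f → f m) wₐ≡uₐ) (partitionSum-linear i c k 1≤i i≤k w≈u w≈v wᵢ n′) ⟩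
    u (suc k) m * (partitionSum u k n′ + c * partitionSum v k n′)
      ≡⟨ solve 4 (λ a x c y → a :* (x :+ c :* y) := a :* x :+ c :* (a :* y)) refl (u (suc k) m) _ c _ ⟩
    u (suc k) m * partitionSum u k n′ + c * (u (suc k) m * partitionSum v k n′)
      ≡⟨ cong (λ f → u (suc k) m * partitionSum u k n′ + c * (f m * partitionSum v k n′)) (≡-trans (sym wₐ≡uₐ) wₐ≡vₐ) ⟩
    u (suc k) m * partitionSum u k n′ + c * (v (suc k) m * partitionSum v k n′) ∎
    where
    i≤k = ℕP.≤-pred (ℕP.≤∧≢⇒< i≤1+k i≢1+k)
    wₐ≡uₐ = w≈u (suc k) (i≢1+k ∘ sym)
    wₐ≡vₐ = w≈v (suc k) (i≢1+k ∘ sym)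

-- If u i = 0, v i 0, v i 1, ... then u's i-th factor is t^i times v's, which shifts the coefficients by i.
ShiftedAt : ℕ → Weights → Weights → Set
ShiftedAt i u v = AgreeExcept i u v × u i 0 ≡ 0ℚ × (∀ m → u i (suc m) ≡ v i m)

partitionSum-shiftTop : ∀ {u v} k → ShiftedAt (suc k) u v →
  ∀ n → partitionSum u (suc k) n ≡ when (suc k ≤? n) (partitionSum v (suc k) (n ∸ suc k))
partitionSum-shiftTop {u} {v} k (u≈v , u₀ , uₛ) n = begin
  F 0 + ∑[ m < n ] F (suc m)   ≡⟨ cong (_+ ∑[ m < n ] F (suc m)) F₀≡0 ⟩
  0ℚ + ∑[ m < n ] F (suc m)    ≡⟨ ℚP.+-identityˡ _ ⟩
  ∑[ m < n ] F (suc m)         ≡⟨ shifted (a ≤? n) ⟩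
  when (a ≤? n) (∑ G (suc (n ∸ a))) ∎
  where
  open ≡-Reasoning
  a = suc k
  F G : ℕ → ℚ
  F m = when (a ℕ.* m ≤? n) (u a m * partitionSum u k (n ∸ a ℕ.* m))
  G m = when (a ℕ.* m ≤? n ∸ a) (v a m * partitionSum v k (n ∸ a ∸ a ℕ.* m))
  F₀≡0 : F 0 ≡ 0ℚ
  F₀≡0 = when-zero (a ℕ.* 0 ≤? n) (≡-trans (cong (_* t₀) u₀) (ℚP.*-zeroˡ t₀))
    where t₀ = partitionSum u k (n ∸ a ℕ.* 0)
  F∘suc≡G : a ≤ n → ∀ m → F (suc m) ≡ G m
  F∘suc≡G a≤n m = when-⇔ (a ℕ.* suc m ≤? n) (a ℕ.* m ≤? n ∸ a)
    (λ le → +≤⇒≤∸ a (subst (_≤ n) (ℕP.*-suc a m) le))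
    (λ le → subst (_≤ n) (sym (ℕP.*-suc a m)) (≤∸⇒+≤ a a≤n le))
    (λ _ → cong₂ _*_ (uₛ m) (≡-trans (partitionSum-agreeBelow a k ℕP.≤-refl u≈v _)
                                     (cong (partitionSum v k) (≡-trans (cong (n ∸_) (ℕP.*-suc a m)) (sym (ℕP.∸-+-assoc n a (a ℕ.* m)))))))
  F∘suc-vanish : ∀ m → ¬ (a ℕ.* suc m ≤ n) → F (suc m) ≡ 0ℚ
  F∘suc-vanish m = when-no (a ℕ.* suc m ≤? n) _
  shifted : (a≤?n : Dec (a ≤ n)) → ∑[ m < n ] F (suc m) ≡ when a≤?n (∑ G (suc (n ∸ a)))
  shifted (yes a≤n@(s≤s _)) = ≡-trans
    (∑-truncate (λ m → F (suc m)) (suc (n ∸ a)) n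
      (λ m n-a<m → F∘suc-vanish m λ le → ℕP.<⇒≱ n-a<m (ℕP.≤-trans (ℕP.m≤n*m m a) (+≤⇒≤∸ a (subst (_≤ n) (ℕP.*-suc a m) le))))
      (s≤s (ℕP.∸-monoʳ-≤ {1} {a} n (s≤s z≤n))))
    (∑-cong (suc (n ∸ a)) λ m _ → F∘suc≡G a≤n m)
  shifted (no a≰n) = ∑-zero _ n λ m _ → F∘suc-vanish m λ le → a≰n (ℕP.≤-trans (ℕP.m≤m*n a (suc m)) le)

partitionSum-shiftBelow : ∀ {u v} i k → AgreeExcept i u v → i ≢ suc k →
  (∀ x → partitionSum u k x ≡ when (i ≤? x) (partitionSum v k (x ∸ i))) →
  ∀ n → partitionSum u (suc k) n ≡ when (i ≤? n) (partitionSum v (suc k) (n ∸ i))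
partitionSum-shiftBelow {u} {v} i k u≈v i≢a shiftₖ n = shifted (i ≤? n)
  where
  a = suc k
  uₐ≡vₐ : u a ≡ v a
  uₐ≡vₐ = u≈v a (i≢a ∘ sym)
  F G : ℕ → ℚ
  F m = when (a ℕ.* m ≤? n) (u a m * partitionSum u k (n ∸ a ℕ.* m))
  G m = when (a ℕ.* m ≤? n ∸ i) (v a m * partitionSum v k (n ∸ i ∸ a ℕ.* m))
  summand-vanish : ∀ m → ¬ (i ≤ n ∸ a ℕ.* m) → u a m * partitionSum u k (n ∸ a ℕ.* m) ≡ 0ℚ
  summand-vanish m i≰ =
    ≡-trans (cong (u a m *_) (≡-trans (shiftₖ _) (when-no (i ≤? n ∸ a ℕ.* m) _ i≰))) (ℚP.*-zeroʳ (u a m))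
  F-vanish : ∀ m → ¬ (a ℕ.* m ≤ n ∸ i) → F m ≡ 0ℚ
  F-vanish m am≰ = guarded (a ℕ.* m ≤? n)
    where
    guarded : (am≤?n : Dec (a ℕ.* m ≤ n)) → when am≤?n (u a m * partitionSum u k (n ∸ a ℕ.* m)) ≡ 0ℚ
    guarded (no _)     = refl
    guarded (yes am≤n) = summand-vanish m λ i≤ →
      am≰ (+≤⇒≤∸ i (subst (_≤ n) (ℕP.+-comm (a ℕ.* m) i) (≤∸⇒+≤ (a ℕ.* m) am≤n i≤)))
  F≡G : i ≤ n → ∀ m → F m ≡ G m
  F≡G i≤n m with a ℕ.* m ≤? n ∸ i
  ... | no  am≰ = F-vanish m am≰
  ... | yes am≤ = ≡-trans (when-yes (a ℕ.* m ≤? n) _ am≤n)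
      (cong₂ _*_ (cong (λ f → f m) uₐ≡vₐ)
                 (≡-trans (shiftₖ _) (≡-trans (when-yes (i ≤? n ∸ a ℕ.* m) _ i≤) (cong (partitionSum v k) (∸-comm n (a ℕ.* m) i)))))
    where
    am≤n = ℕP.≤-trans am≤ (ℕP.m∸n≤m n i)
    i≤   = +≤⇒≤∸ (a ℕ.* m) (subst (_≤ n) (ℕP.+-comm i (a ℕ.* m)) (≤∸⇒+≤ i i≤n am≤))
  shifted : (i≤?n : Dec (i ≤ n)) → ∑ F (suc n) ≡ when i≤?n (∑ G (suc (n ∸ i)))
  shifted (yes i≤n) = ≡-trans
    (∑-truncate F (suc (n ∸ i)) (suc n)
      (λ m n-i<m → F-vanish m λ am≤ → ℕP.<⇒≱ n-i<m (ℕP.≤-trans (ℕP.m≤n*m m a) am≤))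
      (s≤s (ℕP.m∸n≤m n i)))
    (∑-cong (suc (n ∸ i)) λ m _ → F≡G i≤n m)
  shifted (no i≰n) = ∑-zero F (suc n) λ m _ →
    when-zero (a ℕ.* m ≤? n) (summand-vanish m λ i≤ → i≰n (ℕP.≤-trans i≤ (ℕP.m∸n≤m n (a ℕ.* m))))

partitionSum-shift : ∀ i {u v} k → 1 ≤ i → i ≤ k → ShiftedAt i u v →
  ∀ n → partitionSum u k n ≡ when (i ≤? n) (partitionSum v k (n ∸ i))
partitionSum-shift i zero    1≤i i≤0 _ = contradiction (ℕP.≤-trans 1≤i i≤0) λ ()
partitionSum-shift i (suc k) 1≤i i≤1+k shiftedᵢ with i ℕ.≟ suc k
... | yes refl    = partitionSum-shiftTop k shiftedᵢ
... | no  i≢1+k   = partitionSum-shiftBelow i k (proj₁ shiftedᵢ) i≢1+k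
                      (partitionSum-shift i k 1≤i (ℕP.≤-pred (ℕP.≤∧≢⇒< i≤1+k i≢1+k)) shiftedᵢ)

-- The operator t d/dt applied to the factor of the part j: a part j of multiplicity m contributes j m to the size.
euler : ℕ → Weights → Weights
euler j w = w [ j ≔ (λ m → fromℕ (j ℕ.* m) * w j m) ]

-- n = a m + (n - a m): the m parts a contribute a m, the rest is the size of a partition of n - a m.
euler-summand : ∀ w k n m → (∀ n′ → fromℕ n′ * partitionSum w k n′ ≡ ∑[ j < k ] partitionSum (euler (suc j) w) k n′) →
  (am≤?n : Dec (suc k ℕ.* m ≤ n)) →
  fromℕ n * when am≤?n (w (suc k) m * partitionSum w k (n ∸ suc k ℕ.* m)) ≡
  ∑[ j < k ] when am≤?n (w (suc k) m * partitionSum (euler (suc j) w) k (n ∸ suc k ℕ.* m)) +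
  when am≤?n (fromℕ (suc k ℕ.* m) * w (suc k) m * partitionSum w k (n ∸ suc k ℕ.* m))
euler-summand w k n m eulerₖ (no _)     =
  ≡-trans (ℚP.*-zeroʳ (fromℕ n)) (cong (_+ 0ℚ) (sym (∑-zero (λ _ → 0ℚ) k λ _ _ → refl)))
euler-summand w k n m eulerₖ (yes am≤n) = begin
  fromℕ n * (x * t)                              ≡⟨ cong (λ z → fromℕ z * (x * t)) (ℕP.m+[n∸m]≡n am≤n) ⟨
  fromℕ (suc k ℕ.* m ℕ.+ n′) * (x * t)           ≡⟨ cong (_* (x * t)) (fromℕ-homo-+ (suc k ℕ.* m) n′) ⟩
  (c + fromℕ n′) * (x * t)                       ≡⟨ solve 4 (λ c y x t → (c :+ y) :* (x :* t) := x :* (y :* t) :+ c :* x :* t) refl c (fromℕ n′) x t ⟩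
  x * (fromℕ n′ * t) + c * x * t                 ≡⟨ cong (λ z → x * z + c * x * t) (eulerₖ n′) ⟩
  x * ∑[ j < k ] partitionSum (euler (suc j) w) k n′ + c * x * t
                                                 ≡⟨ cong (_+ c * x * t) (∑-distribˡ x (λ j → partitionSum (euler (suc j) w) k n′) k) ⟨
  ∑[ j < k ] (x * partitionSum (euler (suc j) w) k n′) + c * x * t ∎
  where
  open ≡-Reasoning
  n′ = n ∸ suc k ℕ.* m
  x  = w (suc k) m
  t  = partitionSum w k n′
  c  = fromℕ (suc k ℕ.* m)

partitionSum-euler : ∀ w k n → fromℕ n * partitionSum w k n ≡ ∑[ j < k ] partitionSum (euler (suc j) w) k n
partitionSum-euler w zero    zero    = refl
partitionSum-euler w zero    (suc n) = ℚP.*-zeroʳ (fromℕ (suc n))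
partitionSum-euler w (suc k) n       = begin
  fromℕ n * ∑ F (suc n)                                        ≡⟨ ∑-distribˡ (fromℕ n) F (suc n) ⟨
  ∑[ m < suc n ] (fromℕ n * F m)                               ≡⟨ ∑-cong (suc n) (λ m _ → euler-summand w k n m (partitionSum-euler w k) (a ℕ.* m ≤? n)) ⟩
  ∑[ m < suc n ] (∑[ j < k ] A j m + B m)                      ≡⟨ ∑-distrib-+ (λ m → ∑[ j < k ] A j m) B (suc n) ⟩
  ∑[ m < suc n ] ∑[ j < k ] A j m + ∑ B (suc n)                ≡⟨ cong (_+ ∑ B (suc n)) (∑-comm A k (suc n)) ⟨
  ∑[ j < k ] ∑[ m < suc n ] A j m + ∑ B (suc n)                ≡⟨ cong₂ _+_ (∑-cong k λ j j<k → sym (∑A j j<k)) (sym ∑B) ⟩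
  ∑[ j < k ] partitionSum (euler (suc j) w) a n + partitionSum (euler a w) a n
                                                               ≡⟨ ∑-init-last (λ j → partitionSum (euler (suc j) w) a n) k ⟨
  ∑[ j < a ] partitionSum (euler (suc j) w) a n                ∎
  where
  open ≡-Reasoning
  a = suc k
  F B : ℕ → ℚ
  F m   = when (a ℕ.* m ≤? n) (w a m * partitionSum w k (n ∸ a ℕ.* m))
  B m   = when (a ℕ.* m ≤? n) (fromℕ (a ℕ.* m) * w a m * partitionSum w k (n ∸ a ℕ.* m))
  A : ℕ → ℕ → ℚ
  A j m = when (a ℕ.* m ≤? n) (w a m * partitionSum (euler (suc j) w) k (n ∸ a ℕ.* m))
  ∑A : ∀ j → j < k → partitionSum (euler (suc j) w) a n ≡ ∑[ m < suc n ] A j m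
  ∑A j j<k = ∑-cong (suc n) λ m _ →
    cong (λ f → when (a ℕ.* m ≤? n) (f m * partitionSum (euler (suc j) w) k (n ∸ a ℕ.* m)))
         (≔-other w (suc j) (λ m → fromℕ (suc j ℕ.* m) * w (suc j) m) (ℕP.<⇒≢ (s≤s j<k) ∘ sym))
  ∑B : partitionSum (euler a w) a n ≡ ∑ B (suc n)
  ∑B = ∑-cong (suc n) λ m _ → cong (when (a ℕ.* m ≤? n))
    (cong₂ _*_ (cong (λ f → f m) (≔-same w a aw))
               (partitionSum-agreeBelow a k ℕP.≤-refl (λ j → ≔-other w a aw) (n ∸ a ℕ.* m)))
    where aw = λ m → fromℕ (a ℕ.* m) * w a m

invZWeight : Weights
invZWeight i m = recip (m ! ℕ.* i ^ m)

partitionSum-invZ-0 : ∀ k → partitionSum invZWeight k 0 ≡ 1ℚ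
partitionSum-invZ-0 zero    = refl
partitionSum-invZ-0 (suc k) = begin
  when (suc k ℕ.* 0 ≤? 0) (1ℚ * partitionSum invZWeight k (0 ∸ suc k ℕ.* 0)) + 0ℚ ≡⟨ ℚP.+-identityʳ _ ⟩
  when (suc k ℕ.* 0 ≤? 0) (1ℚ * partitionSum invZWeight k (0 ∸ suc k ℕ.* 0))      ≡⟨ when-yes (suc k ℕ.* 0 ≤? 0) _ (ℕP.≤-reflexive (ℕP.*-zeroʳ (suc k))) ⟩
  1ℚ * partitionSum invZWeight k (0 ∸ suc k ℕ.* 0)                               ≡⟨ ℚP.*-identityˡ _ ⟩
  partitionSum invZWeight k (0 ∸ suc k ℕ.* 0)                                    ≡⟨ cong (partitionSum invZWeight k) (ℕP.0∸n≡0 (suc k ℕ.* 0)) ⟩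
  partitionSum invZWeight k 0                                                    ≡⟨ partitionSum-invZ-0 k ⟩
  1ℚ                                                                             ∎
  where open ≡-Reasoning

invZWeight-shift : ∀ i m → fromℕ (suc i ℕ.* suc m) * invZWeight (suc i) (suc m) ≡ invZWeight (suc i) m
invZWeight-shift i m = begin
  fromℕ (a ℕ.* suc m) * recip (suc m ! ℕ.* a ^ suc m)                      ≡⟨ cong (λ z → fromℕ (a ℕ.* suc m) * recip z) (regroup m a) ⟩
  fromℕ (a ℕ.* suc m) * recip (a ℕ.* suc m ℕ.* (m ! ℕ.* a ^ m))            ≡⟨ cong (fromℕ (a ℕ.* suc m) *_) (recip-homo-* (a ℕ.* suc m) (m ! ℕ.* a ^ m)) ⟩
  fromℕ (a ℕ.* suc m) * (recip (a ℕ.* suc m) * invZWeight a m)             ≡⟨ ℚP.*-assoc (fromℕ (a ℕ.* suc m)) _ _ ⟨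
  (fromℕ (a ℕ.* suc m) * recip (a ℕ.* suc m)) * invZWeight a m             ≡⟨ cong (_* invZWeight a m) (fromℕ-*-recip (m ℕ.+ i ℕ.* suc m)) ⟩
  1ℚ * invZWeight a m                                                      ≡⟨ ℚP.*-identityˡ _ ⟩
  invZWeight a m                                                           ∎
  where
  open ≡-Reasoning
  a = suc i
  regroup : ∀ m a → suc m ! ℕ.* a ^ suc m ≡ a ℕ.* suc m ℕ.* (m ! ℕ.* a ^ m)
  regroup m a = begin
    suc m ℕ.* m ! ℕ.* (a ℕ.* a ^ m) ≡⟨ rearrange (suc m) (m !) a (a ^ m) ⟩
    a ℕ.* suc m ℕ.* (m ! ℕ.* a ^ m) ∎
    where
    rearrange : ∀ s f a p → s ℕ.* f ℕ.* (a ℕ.* p) ≡ a ℕ.* s ℕ.* (f ℕ.* p)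
    rearrange = solve-∀

invZWeight-euler : ∀ i → ShiftedAt (suc i) (euler (suc i) invZWeight) invZWeight
invZWeight-euler i =
  (λ j → ≔-other invZWeight (suc i) _) ,
  ≡-trans (cong (λ f → f 0) (≔-same invZWeight (suc i) _))
          (≡-trans (cong (λ z → fromℕ z * invZWeight (suc i) 0) (ℕP.*-zeroʳ (suc i))) (ℚP.*-zeroˡ (invZWeight (suc i) 0))) ,
  λ m → ≡-trans (cong (λ f → f (suc m)) (≔-same invZWeight (suc i) _)) (invZWeight-shift i m)

-- Σ_{ν ⊢ n} 1/z_ν = 1, by induction through n Σ_ν 1/z_ν = Σ_{1 ≤ j ≤ n} Σ_{ν ⊢ n - j} 1/z_ν.
partitionSum-invZ : ∀ n k → n ≤ k → partitionSum invZWeight k n ≡ 1ℚ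
partitionSum-invZ = <-rec _ go
  where
  go : ∀ n → (∀ {n′} → n′ < n → ∀ k → n′ ≤ k → partitionSum invZWeight k n′ ≡ 1ℚ) →
       ∀ k → n ≤ k → partitionSum invZWeight k n ≡ 1ℚ
  go zero        _   k _   = partitionSum-invZ-0 k
  go n@(suc n-1) rec k n≤k = fromℕ-*-cancelˡ n-1 (begin
    fromℕ n * partitionSum invZWeight k n
      ≡⟨ partitionSum-euler invZWeight k n ⟩
    ∑[ j < k ] partitionSum (euler (suc j) invZWeight) k n
      ≡⟨ ∑-cong k (λ j j<k → partitionSum-shift (suc j) k (s≤s z≤n) j<k (invZWeight-euler j) n) ⟩
    ∑[ j < k ] when (suc j ≤? n) (partitionSum invZWeight k (n ∸ suc j))
      ≡⟨ ∑-cong k (λ j _ → when-⇔ (suc j ≤? n) (suc j ≤? n) id id λ j<n →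
                             rec (ℕP.∸-monoʳ-< (s≤s z≤n) j<n) k (ℕP.≤-trans (ℕP.m∸n≤m n (suc j)) n≤k)) ⟩
    ∑[ j < k ] when (suc j ≤? n) 1ℚ
      ≡⟨ ∑-truncate _ n k (λ j n≤j → when-no (suc j ≤? n) 1ℚ (ℕP.<⇒≱ (s≤s n≤j))) n≤k ⟩
    ∑[ j < n ] when (suc j ≤? n) 1ℚ
      ≡⟨ ∑-cong n (λ j j<n → when-yes (suc j ≤? n) 1ℚ j<n) ⟩
    ∑ (λ _ → 1ℚ) n
      ≡⟨ ∑-const-1 n ⟩
    fromℕ n
      ≡⟨ ℚP.*-identityʳ (fromℕ n) ⟨
    fromℕ n * 1ℚ ∎)
    where open ≡-Reasoning

-- Orthogonality

charlierWeight : (ℕ → ℕ) → (ℕ → ℕ) → Weights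
charlierWeight a b i m = charlier i (a i) (fromℕ m) * charlier i (b i) (fromℕ m) * invZWeight i m

charlierNorm : ℕ → ℕ → ℕ → ℚ
charlierNorm i x y with x ℕ.≟ y
... | yes _ = fromℕ (x ! ℕ.* i ^ x)
... | no  _ = 0ℚ

normProduct : (ℕ → ℕ) → (ℕ → ℕ) → ℕ → ℚ
normProduct a b k = ∏[ j < k ] charlierNorm (suc j) (a (suc j)) (b (suc j))

degree weightedDegree : (ℕ → ℕ) → (ℕ → ℕ) → ℕ → ℕ
degree         a b k = ∑ℕ[ j < k ] (a (suc j) ℕ.+ b (suc j))
weightedDegree a b k = ∑ℕ[ j < k ] (suc j ℕ.* (a (suc j) ℕ.+ b (suc j)))

charlierNorm-refl : ∀ i x → charlierNorm i x x ≡ fromℕ (x ! ℕ.* i ^ x)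
charlierNorm-refl i x with x ℕ.≟ x
... | yes _   = refl
... | no  x≢x = contradiction refl x≢x

charlierNorm-≢ : ∀ i {x y} → x ≢ y → charlierNorm i x y ≡ 0ℚ
charlierNorm-≢ i {x} {y} x≢y with x ℕ.≟ y
... | yes x≡y = contradiction x≡y x≢y
... | no  _   = refl

charlierNorm-sym : ∀ i x y → charlierNorm i x y ≡ charlierNorm i y x
charlierNorm-sym i x y with x ℕ.≟ y | y ℕ.≟ x
... | yes refl | yes _   = refl
... | yes x≡y  | no  y≢x = contradiction (sym x≡y) y≢x
... | no  x≢y  | yes y≡x = contradiction (sym y≡x) x≢y
... | no  _    | no  _   = refl

charlierNorm-suc : ∀ i α β → charlierNorm i (suc α) β ≡ fromℕ (i ℕ.* β) * charlierNorm i α (β ∸ 1)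
charlierNorm-suc i α zero    = sym (≡-trans (cong (λ z → fromℕ z * charlierNorm i α 0) (ℕP.*-zeroʳ i))
                                            (ℚP.*-zeroˡ (charlierNorm i α 0)))
charlierNorm-suc i α (suc β) with α ℕ.≟ β
... | yes refl = begin
  charlierNorm i (suc α) (suc α)                   ≡⟨ charlierNorm-refl i (suc α) ⟩
  fromℕ (suc α ! ℕ.* i ^ suc α)                    ≡⟨ cong fromℕ (regroup (α !) i (i ^ α)) ⟩
  fromℕ (i ℕ.* suc α ℕ.* (α ! ℕ.* i ^ α))          ≡⟨ fromℕ-homo-* (i ℕ.* suc α) (α ! ℕ.* i ^ α) ⟩
  fromℕ (i ℕ.* suc α) * fromℕ (α ! ℕ.* i ^ α)      ∎
  where
  open ≡-Reasoning
  regroup : ∀ f i p → suc α ℕ.* f ℕ.* (i ℕ.* p) ≡ i ℕ.* suc α ℕ.* (f ℕ.* p)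
  regroup = solve-∀
... | no α≢β   = ≡-trans (charlierNorm-≢ i (α≢β ∘ ℕP.suc-injective))
                         (sym (ℚP.*-zeroʳ (fromℕ (i ℕ.* suc β))))

partitionSum-charlierWeight-sym : ∀ a b k n → partitionSum (charlierWeight a b) k n ≡ partitionSum (charlierWeight b a) k n
partitionSum-charlierWeight-sym a b k = partitionSum-cong k λ i m _ →
  cong (_* invZWeight (suc i) m) (ℚP.*-comm (charlier (suc i) (a (suc i)) (fromℕ m)) _)

normProduct-sym : ∀ a b k → normProduct a b k ≡ normProduct b a k
normProduct-sym a b k = ∏-cong k λ j _ → charlierNorm-sym (suc j) (a (suc j)) (b (suc j))

degree-sym : ∀ a b k → degree a b k ≡ degree b a k
degree-sym a b k = ∑ℕ-cong k λ j _ → ℕP.+-comm (a (suc j)) (b (suc j))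

weightedDegree-sym : ∀ a b k → weightedDegree a b k ≡ weightedDegree b a k
weightedDegree-sym a b k = ∑ℕ-cong k λ j _ → cong (suc j ℕ.*_) (ℕP.+-comm (a (suc j)) (b (suc j)))

module Lowering (a b : ℕ → ℕ) {j α : ℕ} (aᵢ≡1+α : a (suc j) ≡ suc α) where

  i β : ℕ
  i = suc j
  β = b i

  a′ b′ : ℕ → ℕ
  a′ = a [ i ≔ α ]
  b′ = b [ i ≔ β ∸ 1 ]

  c : ℚ
  c = fromℕ (i ℕ.* β)

  private
    a′≡a : ∀ {j′} → j′ ≢ i → a′ j′ ≡ a j′
    a′≡a = ≔-other a i α

    b′≡b : ∀ {j′} → j′ ≢ i → b′ j′ ≡ b j′
    b′≡b = ≔-other b i (β ∸ 1)

    suc≢i : ∀ {j′} → j′ ≢ j → suc j′ ≢ i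
    suc≢i j′≢j = j′≢j ∘ ℕP.suc-injective

  degree-lower : ∀ k → j < k → degree a b k ≡ 1 ℕ.+ degree a′ b k
  degree-lower k j<k = ∑ℕ-addAt _ _ 1 k j j<k
    (cong (ℕ._+ β) (≡-trans aᵢ≡1+α (cong suc (sym (≔-same a i α)))))
    (λ j′ _ j′≢j → cong (ℕ._+ b (suc j′)) (sym (a′≡a (suc≢i j′≢j))))

  weightedDegree-lower : ∀ k → j < k → weightedDegree a b k ≡ i ℕ.+ weightedDegree a′ b k
  weightedDegree-lower k j<k = ∑ℕ-addAt _ _ i k j j<k
    (≡-trans (cong (λ z → i ℕ.* (z ℕ.+ β)) (≡-trans aᵢ≡1+α (cong suc (sym (≔-same a i α))))) (ℕP.*-suc i (a′ i ℕ.+ β)))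
    (λ j′ _ j′≢j → cong (λ z → suc j′ ℕ.* (z ℕ.+ b (suc j′))) (sym (a′≡a (suc≢i j′≢j))))

  b′≤b : ∀ j′ → b′ j′ ≤ b j′
  b′≤b j′ with j′ ℕ.≟ i
  ... | yes refl = ℕP.m∸n≤m β 1
  ... | no  _    = ℕP.≤-refl

  degree-b′≤ : ∀ k → degree a′ b′ k ≤ degree a′ b k
  degree-b′≤ k = ∑ℕ-mono-≤ k λ j′ _ → ℕP.+-monoʳ-≤ (a′ (suc j′)) (b′≤b (suc j′))

  weightedDegree-b′≤ : ∀ k → weightedDegree a′ b′ k ≤ weightedDegree a′ b k
  weightedDegree-b′≤ k = ∑ℕ-mono-≤ k λ j′ _ → ℕP.*-monoʳ-≤ (suc j′) (ℕP.+-monoʳ-≤ (a′ (suc j′)) (b′≤b (suc j′)))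

  normProduct-lower : ∀ k → j < k → normProduct a b k ≡ c * normProduct a′ b′ k
  normProduct-lower k j<k = ∏-scaleAt _ _ c k j j<k
    (≡-trans (cong (λ z → charlierNorm i z β) aᵢ≡1+α)
      (≡-trans (charlierNorm-suc i α β) (cong₂ (λ x y → c * charlierNorm i x y) (sym (≔-same a i α)) (sym (≔-same b i (β ∸ 1))))))
    (λ j′ _ j′≢j → cong₂ (charlierNorm (suc j′)) (sym (a′≡a (suc≢i j′≢j))) (sym (b′≡b (suc≢i j′≢j))))

  lowered : ℕ → ℚ
  lowered m = fromℕ i * fromℕ m * charlier i α (fromℕ m - 1ℚ) * charlier i β (fromℕ m) * invZWeight i m

  charlierWeight-lower : ∀ m → charlierWeight a b i m ≡ lowered m + (- 1ℚ) * charlierWeight a′ b i m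
  charlierWeight-lower m = begin
    charlier i (a i) X * charlier i β X * invZWeight i m
      ≡⟨ cong (λ r → charlier i r X * charlier i β X * invZWeight i m) aᵢ≡1+α ⟩
    charlier i (suc α) X * charlier i β X * invZWeight i m
      ≡⟨ cong (λ z → z * charlier i β X * invZWeight i m) (charlier-suc i α X) ⟩
    (fromℕ i * X * charlier i α (X - 1ℚ) - charlier i α X) * charlier i β X * invZWeight i m
      ≡⟨ solve 6 (λ I X p q r s → (I :* X :* p :- q) :* r :* s := I :* X :* p :* r :* s :+ (:- con 1ℚ) :* (q :* r :* s)) refl
           (fromℕ i) X (charlier i α (X - 1ℚ)) (charlier i α X) (charlier i β X) (invZWeight i m) ⟩
    lowered m + (- 1ℚ) * (charlier i α X * charlier i β X * invZWeight i m)
      ≡⟨ cong (λ r → lowered m + (- 1ℚ) * (charlier i r X * charlier i β X * invZWeight i m)) (sym (≔-same a i α)) ⟩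
    lowered m + (- 1ℚ) * charlierWeight a′ b i m ∎
    where
    open ≡-Reasoning
    X = fromℕ m

  lowered-suc : ∀ m → lowered (suc m) ≡ charlierWeight a′ b i m + c * charlierWeight a′ b′ i m
  lowered-suc m = begin
    fromℕ i * fromℕ (suc m) * charlier i α (fromℕ (suc m) - 1ℚ) * charlier i β (fromℕ (suc m)) * invZWeight i (suc m)
      ≡⟨ cong₂ (λ x y → fromℕ i * fromℕ (suc m) * charlier i α x * charlier i β y * invZWeight i (suc m)) X+1-1≡X X+1≡1+X ⟩
    fromℕ i * fromℕ (suc m) * p * charlier i β (X + 1ℚ) * invZWeight i (suc m)
      ≡⟨ solve 5 (λ I S p q r → I :* S :* p :* q :* r := p :* q :* (I :* S :* r)) refl
               (fromℕ i) (fromℕ (suc m)) p (charlier i β (X + 1ℚ)) (invZWeight i (suc m)) ⟩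
    p * charlier i β (X + 1ℚ) * (fromℕ i * fromℕ (suc m) * invZWeight i (suc m))
      ≡⟨ cong₂ (λ x y → p * x * y) (charlier-shift i β X)
               (≡-trans (cong (_* invZWeight i (suc m)) (sym (fromℕ-homo-* i (suc m)))) (invZWeight-shift j m)) ⟩
    p * (charlier i β X + c * charlier i (β ∸ 1) X) * invZWeight i m
      ≡⟨ solve 5 (λ p q c s r → p :* (q :+ c :* s) :* r := p :* q :* r :+ c :* (p :* s :* r)) refl p (charlier i β X) c (charlier i (β ∸ 1) X) (invZWeight i m) ⟩
    p * charlier i β X * invZWeight i m + c * (p * charlier i (β ∸ 1) X * invZWeight i m)
      ≡⟨ cong₂ (λ x y → charlier i x X * charlier i β X * invZWeight i m + c * (charlier i x X * charlier i y X * invZWeight i m))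
               (sym (≔-same a i α)) (sym (≔-same b i (β ∸ 1))) ⟩
    charlierWeight a′ b i m + c * charlierWeight a′ b′ i m ∎
    where
    open ≡-Reasoning
    X = fromℕ m
    p = charlier i α X
    X+1-1≡X : fromℕ (suc m) - 1ℚ ≡ X
    X+1-1≡X = ≡-trans (cong (_- 1ℚ) (fromℕ-suc m)) (solve 1 (λ x → con 1ℚ :+ x :- con 1ℚ := x) refl X)
    X+1≡1+X : fromℕ (suc m) ≡ X + 1ℚ
    X+1≡1+X = ≡-trans (fromℕ-suc m) (ℚP.+-comm 1ℚ X)

  private
    W wA wB : Weights
    W  = charlierWeight a b
    wA = W [ i ≔ lowered ]
    wB = W [ i ≔ lowered ∘ suc ]

    W≈W′ : ∀ a₁ b₁ a₂ b₂ → (∀ {j′} → j′ ≢ i → a₁ j′ ≡ a₂ j′) → (∀ {j′} → j′ ≢ i → b₁ j′ ≡ b₂ j′) →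
           AgreeExcept i (charlierWeight a₁ b₁) (charlierWeight a₂ b₂)
    W≈W′ _ _ _ _ eqa eqb j′ j′≢i = cong₂ (λ x y m → charlier j′ x (fromℕ m) * charlier j′ y (fromℕ m) * invZWeight j′ m) (eqa j′≢i) (eqb j′≢i)

    patched≈ : ∀ f a₂ b₂ → (∀ {j′} → j′ ≢ i → a j′ ≡ a₂ j′) → (∀ {j′} → j′ ≢ i → b j′ ≡ b₂ j′) →
               AgreeExcept i (W [ i ≔ f ]) (charlierWeight a₂ b₂)
    patched≈ f a₂ b₂ eqa eqb j′ j′≢i = ≡-trans (≔-other W i f j′≢i) (W≈W′ a b a₂ b₂ eqa eqb j′ j′≢i)

  partitionSum-lower : ∀ k n → j < k → i ≤ n →
    partitionSum W k n ≡ (partitionSum (charlierWeight a′ b) k (n ∸ i) + c * partitionSum (charlierWeight a′ b′) k (n ∸ i))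
                         + (- 1ℚ) * partitionSum (charlierWeight a′ b) k n
  partitionSum-lower k n j<k i≤n = begin
    partitionSum W k n
      ≡⟨ partitionSum-linear i (- 1ℚ) k (s≤s z≤n) j<k (λ j′ j′≢i → sym (≔-other W i lowered j′≢i)) (W≈W′ a b a′ b (sym ∘ a′≡a) (λ _ → refl))
           (λ m → ≡-trans (charlierWeight-lower m) (cong (_+ (- 1ℚ) * charlierWeight a′ b i m) (sym (cong (λ f → f m) (≔-same W i lowered))))) n ⟩
    partitionSum wA k n + (- 1ℚ) * partitionSum (charlierWeight a′ b) k n
      ≡⟨ cong (_+ (- 1ℚ) * partitionSum (charlierWeight a′ b) k n) (≡-trans shifted (when-yes (i ≤? n) _ i≤n)) ⟩
    partitionSum wB k (n ∸ i) + (- 1ℚ) * partitionSum (charlierWeight a′ b) k n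
      ≡⟨ cong (_+ (- 1ℚ) * partitionSum (charlierWeight a′ b) k n) raised ⟩
    (partitionSum (charlierWeight a′ b) k (n ∸ i) + c * partitionSum (charlierWeight a′ b′) k (n ∸ i))
      + (- 1ℚ) * partitionSum (charlierWeight a′ b) k n ∎
    where
    open ≡-Reasoning
    lowered₀ : lowered 0 ≡ 0ℚ
    lowered₀ = solve 4 (λ I p q r → I :* con 0ℚ :* p :* q :* r := con 0ℚ) refl
                 (fromℕ i) (charlier i α (0ℚ - 1ℚ)) (charlier i β 0ℚ) (invZWeight i 0)
    shifted : partitionSum wA k n ≡ when (i ≤? n) (partitionSum wB k (n ∸ i))
    shifted = partitionSum-shift i k (s≤s z≤n) j<k
      ( (λ j′ j′≢i → ≡-trans (≔-other W i lowered j′≢i) (sym (≔-other W i (lowered ∘ suc) j′≢i)))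
      , ≡-trans (cong (λ f → f 0) (≔-same W i lowered)) lowered₀
      , λ m → ≡-trans (cong (λ f → f (suc m)) (≔-same W i lowered)) (sym (cong (λ f → f m) (≔-same W i (lowered ∘ suc))))) n
    raised : partitionSum wB k (n ∸ i) ≡ partitionSum (charlierWeight a′ b) k (n ∸ i) + c * partitionSum (charlierWeight a′ b′) k (n ∸ i)
    raised = partitionSum-linear i c k (s≤s z≤n) j<k
      (patched≈ (lowered ∘ suc) a′ b (sym ∘ a′≡a) (λ _ → refl)) (patched≈ (lowered ∘ suc) a′ b′ (sym ∘ a′≡a) (sym ∘ b′≡b))
      (λ m → ≡-trans (cong (λ f → f m) (≔-same W i (lowered ∘ suc))) (lowered-suc m)) (n ∸ i)

-- The Charlier polynomials of degrees a i and b i are orthogonal for the weight 1 / (m! i^m); the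
-- partition sum of size n is exact, i.e. equals the product of the norms, as soon as n ≥ Σ i (a i + b i).
Orthogonal : ℕ → ℕ → Set
Orthogonal F k = ∀ a b n → degree a b k ≤ F → weightedDegree a b k ≤ n → n ≤ k →
                 partitionSum (charlierWeight a b) k n ≡ normProduct a b k

orthogonality-lower : ∀ F k → Orthogonal F k → ∀ a b n {j α} → j < k → a (suc j) ≡ suc α →
  degree a b k ≤ suc F → weightedDegree a b k ≤ n → n ≤ k → partitionSum (charlierWeight a b) k n ≡ normProduct a b k
orthogonality-lower F k orthogonal a b n {j} {α} j<k aᵢ≡1+α deg≤ wdeg≤n n≤k = begin
  partitionSum (charlierWeight a b) k n
    ≡⟨ partitionSum-lower k n j<k i≤n ⟩
  (partitionSum (charlierWeight a′ b) k (n ∸ i) + c * partitionSum (charlierWeight a′ b′) k (n ∸ i))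
    + (- 1ℚ) * partitionSum (charlierWeight a′ b) k n
    ≡⟨ cong₂ (λ x y → x + (- 1ℚ) * y)
         (cong₂ (λ x y → x + c * y) (orthogonal a′ b (n ∸ i) deg′≤ wdeg′≤ n-i≤k) (orthogonal a′ b′ (n ∸ i) deg″≤ wdeg″≤ n-i≤k))
         (orthogonal a′ b n deg′≤ (ℕP.≤-trans wdeg′≤ (ℕP.m∸n≤m n i)) n≤k) ⟩
  (normProduct a′ b k + c * normProduct a′ b′ k) + (- 1ℚ) * normProduct a′ b k
    ≡⟨ solve 3 (λ x c y → (x :+ c :* y) :+ (:- con 1ℚ) :* x := c :* y) refl (normProduct a′ b k) c (normProduct a′ b′ k) ⟩
  c * normProduct a′ b′ k
    ≡⟨ normProduct-lower k j<k ⟨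
  normProduct a b k ∎
  where
  open ≡-Reasoning
  open Lowering a b aᵢ≡1+α
  i+wdeg′≤n : i ℕ.+ weightedDegree a′ b k ≤ n
  i+wdeg′≤n = subst (_≤ n) (weightedDegree-lower k j<k) wdeg≤n
  i≤n = ℕP.m+n≤o⇒m≤o i i+wdeg′≤n
  n-i≤k = ℕP.≤-trans (ℕP.m∸n≤m n i) n≤k
  deg′≤ : degree a′ b k ≤ F
  deg′≤ = ℕP.≤-pred (subst (_≤ suc F) (degree-lower k j<k) deg≤)
  deg″≤ = ℕP.≤-trans (degree-b′≤ k) deg′≤
  wdeg′≤ : weightedDegree a′ b k ≤ n ∸ i
  wdeg′≤ = +≤⇒≤∸ i i+wdeg′≤n
  wdeg″≤ = ℕP.≤-trans (weightedDegree-b′≤ k) wdeg′≤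

orthogonality-base : ∀ k a b n → n ≤ k → (∀ j → j < k → a (suc j) ≡ 0 × b (suc j) ≡ 0) →
  partitionSum (charlierWeight a b) k n ≡ normProduct a b k
orthogonality-base k a b n n≤k zero-degree = begin
  partitionSum (charlierWeight a b) k n ≡⟨ partitionSum-cong k (λ i m i<k → invZ-factor i m (zero-degree i i<k)) n ⟩
  partitionSum invZWeight k n           ≡⟨ partitionSum-invZ n k n≤k ⟩
  1ℚ                                    ≡⟨ ∏-one _ k (λ j j<k → norm-one j (zero-degree j j<k)) ⟨
  normProduct a b k                     ∎
  where
  open ≡-Reasoning
  invZ-factor : ∀ i m → a (suc i) ≡ 0 × b (suc i) ≡ 0 → charlierWeight a b (suc i) m ≡ invZWeight (suc i) m
  invZ-factor i m (aᵢ≡0 , bᵢ≡0) = begin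
    charlier (suc i) (a (suc i)) X * charlier (suc i) (b (suc i)) X * invZWeight (suc i) m
      ≡⟨ cong₂ (λ x y → charlier (suc i) x X * charlier (suc i) y X * invZWeight (suc i) m) aᵢ≡0 bᵢ≡0 ⟩
    charlier (suc i) 0 X * charlier (suc i) 0 X * invZWeight (suc i) m
      ≡⟨ cong₂ (λ x y → x * y * invZWeight (suc i) m) (charlier-0 (suc i) X) (charlier-0 (suc i) X) ⟩
    1ℚ * 1ℚ * invZWeight (suc i) m
      ≡⟨ cong (_* invZWeight (suc i) m) (ℚP.*-identityˡ 1ℚ) ⟩
    1ℚ * invZWeight (suc i) m
      ≡⟨ ℚP.*-identityˡ (invZWeight (suc i) m) ⟩
    invZWeight (suc i) m ∎
    where X = fromℕ m
  norm-one : ∀ j → a (suc j) ≡ 0 × b (suc j) ≡ 0 → charlierNorm (suc j) (a (suc j)) (b (suc j)) ≡ 1ℚ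
  norm-one j (aⱼ≡0 , bⱼ≡0) = ≡-trans (cong₂ (charlierNorm (suc j)) aⱼ≡0 bⱼ≡0) (charlierNorm-refl (suc j) 0)

orthogonality-nonzero : ∀ F k → Orthogonal F k → ∀ a b n {j} → j < k → a (suc j) ℕ.+ b (suc j) ≢ 0 →
  degree a b k ≤ suc F → weightedDegree a b k ≤ n → n ≤ k → partitionSum (charlierWeight a b) k n ≡ normProduct a b k
orthogonality-nonzero F k orthogonal a b n {j} j<k a+b≢0 deg≤ wdeg≤n n≤k = cases (a (suc j)) (b (suc j)) refl refl
  where
  open ≡-Reasoning
  cases : ∀ x y → a (suc j) ≡ x → b (suc j) ≡ y → partitionSum (charlierWeight a b) k n ≡ normProduct a b k
  cases (suc α) _       aⱼ≡ _   = orthogonality-lower F k orthogonal a b n j<k aⱼ≡ deg≤ wdeg≤n n≤k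
  cases zero    (suc β) _   bⱼ≡ = begin
    partitionSum (charlierWeight a b) k n ≡⟨ partitionSum-charlierWeight-sym a b k n ⟩
    partitionSum (charlierWeight b a) k n ≡⟨ orthogonality-lower F k orthogonal b a n j<k bⱼ≡
                                               (subst (_≤ suc F) (degree-sym a b k) deg≤) (subst (_≤ n) (weightedDegree-sym a b k) wdeg≤n) n≤k ⟩
    normProduct b a k                     ≡⟨ normProduct-sym b a k ⟩
    normProduct a b k                     ∎
  cases zero    zero    aⱼ≡ bⱼ≡ = contradiction (cong₂ ℕ._+_ aⱼ≡ bⱼ≡) a+b≢0

orthogonality : ∀ F k → Orthogonal F k
orthogonality F k a b n deg≤F wdeg≤n n≤k = cases F deg≤F (ℕP.anyUpTo? (λ j → ¬? (a (suc j) ℕ.+ b (suc j) ℕ.≟ 0)) k)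
  where
  cases : ∀ F → degree a b k ≤ F → Dec (∃[ j ] (j < k × a (suc j) ℕ.+ b (suc j) ≢ 0)) →
          partitionSum (charlierWeight a b) k n ≡ normProduct a b k
  cases _        _     (no none) = orthogonality-base k a b n n≤k zero-degree
    where
    zero-degree : ∀ j → j < k → a (suc j) ≡ 0 × b (suc j) ≡ 0
    zero-degree j j<k with a (suc j) ℕ.+ b (suc j) ℕ.≟ 0
    ... | yes a+b≡0 = ℕP.m+n≡0⇒m≡0 (a (suc j)) a+b≡0 , ℕP.m+n≡0⇒n≡0 (a (suc j)) a+b≡0
    ... | no  a+b≢0 = contradiction (j , j<k , a+b≢0) none
  cases zero     deg≤0 (yes (j , j<k , a+b≢0)) =
    contradiction (ℕP.n≤0⇒n≡0 (ℕP.≤-trans (term≤∑ℕ (λ j → a (suc j) ℕ.+ b (suc j)) k j j<k) deg≤0)) a+b≢0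
  cases (suc F′) deg≤  (yes (j , j<k , a+b≢0)) =
    orthogonality-nonzero F′ k (orthogonality F′ k) a b n j<k a+b≢0 deg≤ wdeg≤n n≤k

-- Enumerating partitions

Bounded : ℕ → List ℕ → Set
Bounded k []      = ⊤
Bounded k (x ∷ ν) = 1 ≤ x × x ≤ k × Bounded x ν

Bounded-weaken : ∀ {k k′} ν → k ≤ k′ → Bounded k ν → Bounded k′ ν
Bounded-weaken []      _    _                = tt
Bounded-weaken (x ∷ ν) k≤k′ (1≤x , x≤k , bd) = 1≤x , ℕP.≤-trans x≤k k≤k′ , bd

Bounded-replicate : ∀ k m ρ → Bounded k ρ → Bounded (suc k) (replicate m (suc k) ++ ρ)
Bounded-replicate k zero    ρ bd = Bounded-weaken ρ (ℕP.n≤1+n k) bd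
Bounded-replicate k (suc m) ρ bd = s≤s z≤n , ℕP.≤-refl , Bounded-replicate k m ρ bd

Bounded-∈ : ∀ {k x} ν → Bounded k ν → x ∈ ν → 1 ≤ x × x ≤ k
Bounded-∈ (y ∷ ν) (1≤y , y≤k , _)  (here refl) = 1≤y , y≤k
Bounded-∈ (y ∷ ν) (_   , y≤k , bd) (there x∈)  = let 1≤x , x≤y = Bounded-∈ ν bd x∈ in 1≤x , ℕP.≤-trans x≤y y≤k

Bounded-split : ∀ k ν → Bounded (suc k) ν → ∃[ m ] ∃[ ρ ] (ν ≡ replicate m (suc k) ++ ρ × Bounded k ρ)
Bounded-split k []      _ = 0 , [] , refl , tt
Bounded-split k (x ∷ ν) (1≤x , x≤1+k , bd) with x ℕ.≟ suc k
... | yes refl = let m , ρ , ν≡ , bdρ = Bounded-split k ν bd in suc m , ρ , cong (suc k ∷_) ν≡ , bdρ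
... | no  x≢   = 0 , x ∷ ν , refl , 1≤x , ℕP.≤-pred (ℕP.≤∧≢⇒< x≤1+k x≢) , bd

size-replicate : ∀ m v ρ → size (replicate m v ++ ρ) ≡ m ℕ.* v ℕ.+ size ρ
size-replicate zero    v ρ = refl
size-replicate (suc m) v ρ = ≡-trans (cong (v ℕ.+_) (size-replicate m v ρ)) (sym (ℕP.+-assoc v (m ℕ.* v) _))

mult-absent : ∀ i ν → i ∉ ν → mult i ν ≡ 0
mult-absent i []      _   = refl
mult-absent i (x ∷ ν) i∉ =
  ≡-trans (cong length (LP.filter-reject (ℕ._≟ i) {x = x} {xs = ν} (λ x≡i → i∉ (here (sym x≡i)))))
          (mult-absent i ν (i∉ ∘ there))

mult-replicate-other : ∀ i m v ρ → v ≢ i → mult i (replicate m v ++ ρ) ≡ mult i ρ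
mult-replicate-other i zero    v ρ v≢i = refl
mult-replicate-other i (suc m) v ρ v≢i =
  ≡-trans (cong length (LP.filter-reject (ℕ._≟ i) {x = v} {xs = replicate m v ++ ρ} v≢i)) (mult-replicate-other i m v ρ v≢i)

mult-replicate-same : ∀ m v ρ → mult v (replicate m v ++ ρ) ≡ m ℕ.+ mult v ρ
mult-replicate-same zero    v ρ = refl
mult-replicate-same (suc m) v ρ =
  ≡-trans (cong length (LP.filter-accept (ℕ._≟ v) {x = v} {xs = replicate m v ++ ρ} refl)) (cong suc (mult-replicate-same m v ρ))

mult-replicate-top : ∀ k m ρ → Bounded k ρ → mult (suc k) (replicate m (suc k) ++ ρ) ≡ m
mult-replicate-top k m ρ bd = ≡-trans (mult-replicate-same m (suc k) ρ)
  (≡-trans (cong (m ℕ.+_) (mult-absent (suc k) ρ λ 1+k∈ → ℕP.<-irrefl refl (proj₂ (Bounded-∈ ρ bd 1+k∈))))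
           (ℕP.+-identityʳ m))

prependCopies : ∀ {P : Set} → Dec P → ℕ → ℕ → List (List ℕ) → List (List ℕ)
prependCopies (yes _) m v ρs = map (replicate m v ++_) ρs
prependCopies (no  _) _ _ _  = []

∈-prependCopies⁻ : ∀ {P : Set} (P? : Dec P) m v ρs {ν} → ν ∈ prependCopies P? m v ρs →
                   P × ∃[ ρ ] (ρ ∈ ρs × ν ≡ replicate m v ++ ρ)
∈-prependCopies⁻ (yes p) m v ρs ν∈ = let ρ , ρ∈ , ν≡ = ∈P.∈-map⁻ (replicate m v ++_) ν∈ in p , ρ , ρ∈ , ν≡

-- partitionsUpTo k n lists the partitions of n into parts ≤ k, and withTopCopies k n m those of them into
-- parts ≤ k + 1 having exactly m parts equal to k + 1.
partitionsUpTo : ℕ → ℕ → List (List ℕ)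
withTopCopies : ℕ → ℕ → ℕ → List (List ℕ)

partitionsUpTo zero    zero    = [] ∷ []
partitionsUpTo zero    (suc n) = []
partitionsUpTo (suc k) n       = concatMap (withTopCopies k n) (upTo (suc n))

withTopCopies k n m = prependCopies (suc k ℕ.* m ≤? n) m (suc k) (partitionsUpTo k (n ∸ suc k ℕ.* m))

∈-partitionsUpTo-suc⁻ : ∀ k n {ν} → ν ∈ partitionsUpTo (suc k) n →
  ∃[ m ] (suc k ℕ.* m ≤ n × ∃[ ρ ] (ρ ∈ partitionsUpTo k (n ∸ suc k ℕ.* m) × ν ≡ replicate m (suc k) ++ ρ))
∈-partitionsUpTo-suc⁻ k n ν∈ with ∈P.∈-concat⁻′ (map (withTopCopies k n) (upTo (suc n))) ν∈
... | _ , ν∈blk , blk∈ with ∈P.∈-map⁻ (withTopCopies k n) {xs = upTo (suc n)} blk∈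
...   | m , _ , refl = m , ∈-prependCopies⁻ (suc k ℕ.* m ≤? n) m (suc k) (partitionsUpTo k (n ∸ suc k ℕ.* m)) ν∈blk

partitionsUpTo-sound : ∀ k n {ν} → ν ∈ partitionsUpTo k n → Bounded k ν × size ν ≡ n
partitionsUpTo-sound zero    zero    (here refl) = tt , refl
partitionsUpTo-sound (suc k) n       ν∈ with ∈-partitionsUpTo-suc⁻ k n ν∈
... | m , km≤n , ρ , ρ∈ , refl = let bd , size≡ = partitionsUpTo-sound k _ ρ∈ in
  Bounded-replicate k m ρ bd ,
  ≡-trans (size-replicate m (suc k) ρ) (≡-trans (cong₂ ℕ._+_ (ℕP.*-comm m (suc k)) size≡) (ℕP.m+[n∸m]≡n km≤n))

partitionsUpTo-complete : ∀ k n ν → Bounded k ν → size ν ≡ n → ν ∈ partitionsUpTo k n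
partitionsUpTo-complete zero    zero    []      _               _ = here refl
partitionsUpTo-complete zero    n       (x ∷ ν) (1≤x , x≤0 , _) _ = contradiction (ℕP.≤-trans 1≤x x≤0) λ ()
partitionsUpTo-complete (suc k) n       ν       bd          size≡ with Bounded-split k ν bd
... | m , ρ , refl , bdρ =
  ∈P.∈-concat⁺′ (in-block (suc k ℕ.* m ≤? n)) (∈P.∈-map⁺ (withTopCopies k n) (∈P.∈-upTo⁺ (s≤s (ℕP.≤-trans (ℕP.m≤n*m m (suc k)) km≤n))))
  where
  km+|ρ|≡n : suc k ℕ.* m ℕ.+ size ρ ≡ n
  km+|ρ|≡n = ≡-trans (cong (ℕ._+ size ρ) (ℕP.*-comm (suc k) m)) (≡-trans (sym (size-replicate m (suc k) ρ)) size≡)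
  km≤n : suc k ℕ.* m ≤ n
  km≤n = subst (suc k ℕ.* m ≤_) km+|ρ|≡n (ℕP.m≤m+n _ _)
  |ρ|≡ : size ρ ≡ n ∸ suc k ℕ.* m
  |ρ|≡ = sym (≡-trans (cong (_∸ suc k ℕ.* m) (sym km+|ρ|≡n)) (ℕP.m+n∸m≡n (suc k ℕ.* m) (size ρ)))
  in-block : (P? : Dec (suc k ℕ.* m ≤ n)) → replicate m (suc k) ++ ρ ∈ prependCopies P? m (suc k) (partitionsUpTo k (n ∸ suc k ℕ.* m))
  in-block (yes _)   = ∈P.∈-map⁺ (replicate m (suc k) ++_) (partitionsUpTo-complete k _ ρ bdρ |ρ|≡)
  in-block (no km≰n) = contradiction km≤n km≰n

partitionsUpTo-unique : ∀ k n → Unique (partitionsUpTo k n)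
partitionsUpTo-unique zero    zero    = All.[] ∷ []
partitionsUpTo-unique zero    (suc n) = []
partitionsUpTo-unique (suc k) n       = UniqueP.concat⁺ {xss = map (withTopCopies k n) (upTo (suc n))}
  (AllP.map⁺ {f = withTopCopies k n} (All.tabulate {xs = upTo (suc n)} λ {m} _ → block-unique m (suc k ℕ.* m ≤? n)))
  (AllPairsP.map⁺ {f = withTopCopies k n} {xs = upTo (suc n)}
    (AllPairs.map (λ m≢m′ {ν} (ν∈ , ν∈′) → m≢m′ (≡-trans (sym (mult-block ν∈)) (mult-block ν∈′))) (UniqueP.upTo⁺ (suc n))))
  where
  block-unique : ∀ m (P? : Dec (suc k ℕ.* m ≤ n)) → Unique (prependCopies P? m (suc k) (partitionsUpTo k (n ∸ suc k ℕ.* m)))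
  block-unique m (yes _) = UniqueP.map⁺ (LP.++-cancelˡ (replicate m (suc k)) _ _) (partitionsUpTo-unique k _)
  block-unique m (no _)  = []
  mult-block : ∀ {m ν} → ν ∈ withTopCopies k n m → mult (suc k) ν ≡ m
  mult-block {m} ν∈ with ∈-prependCopies⁻ (suc k ℕ.* m ≤? n) m (suc k) (partitionsUpTo k (n ∸ suc k ℕ.* m)) ν∈
  ... | _ , ρ , ρ∈ , refl = mult-replicate-top k m ρ (proj₁ (partitionsUpTo-sound k _ ρ∈))

weightOf : Weights → ℕ → List ℕ → ℚ
weightOf w k ν = ∏[ j < k ] w (suc j) (mult (suc j) ν)

weightOf-replicate : ∀ w k m ρ → Bounded k ρ → weightOf w (suc k) (replicate m (suc k) ++ ρ) ≡ w (suc k) m * weightOf w k ρ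
weightOf-replicate w k m ρ bd = begin
  weightOf w (suc k) (replicate m (suc k) ++ ρ)
    ≡⟨ ∏-init-last _ k ⟩
  weightOf w k (replicate m (suc k) ++ ρ) * w (suc k) (mult (suc k) (replicate m (suc k) ++ ρ))
    ≡⟨ cong₂ _*_ (∏-cong k λ j j<k → cong (w (suc j)) (mult-replicate-other (suc j) m (suc k) ρ (ℕP.<⇒≢ (s≤s j<k) ∘ sym)))
                 (cong (w (suc k)) (mult-replicate-top k m ρ bd)) ⟩
  weightOf w k ρ * w (suc k) m
    ≡⟨ ℚP.*-comm (weightOf w k ρ) (w (suc k) m) ⟩
  w (suc k) m * weightOf w k ρ ∎
  where open ≡-Reasoning

sum-partitionsUpTo : ∀ w k n → sumℚ (map (weightOf w k) (partitionsUpTo k n)) ≡ partitionSum w k n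
sum-partitionsUpTo w zero    zero    = ℚP.+-identityʳ 1ℚ
sum-partitionsUpTo w zero    (suc n) = refl
sum-partitionsUpTo w (suc k) n       = begin
  sumℚ (map F (concat (map block (upTo (suc n)))))         ≡⟨ sumℚ-concat F (map block (upTo (suc n))) ⟩
  sumℚ (map (sumℚ ∘ map F) (map block (upTo (suc n))))     ≡⟨ cong sumℚ (LP.map-∘ {g = sumℚ ∘ map F} {f = block} (upTo (suc n))) ⟨
  sumℚ (map (sumℚ ∘ map F ∘ block) (upTo (suc n)))         ≡⟨ sumℚ-applyUpTo (sumℚ ∘ map F ∘ block) (λ m → m) (suc n) ⟩
  ∑[ m < suc n ] sumℚ (map F (block m))                    ≡⟨ ∑-cong (suc n) (λ m _ → sum-block m (suc k ℕ.* m ≤? n)) ⟩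
  partitionSum w (suc k) n                                 ∎
  where
  open ≡-Reasoning
  F = weightOf w (suc k)
  block = withTopCopies k n
  sum-block : ∀ m (P? : Dec (suc k ℕ.* m ≤ n)) →
    sumℚ (map F (prependCopies P? m (suc k) (partitionsUpTo k (n ∸ suc k ℕ.* m)))) ≡
    when P? (w (suc k) m * partitionSum w k (n ∸ suc k ℕ.* m))
  sum-block m (no _)  = refl
  sum-block m (yes _) = begin
    sumℚ (map F (map (replicate m (suc k) ++_) ρs))           ≡⟨ cong sumℚ (LP.map-∘ {g = F} {f = replicate m (suc k) ++_} ρs) ⟨
    sumℚ (map (F ∘ (replicate m (suc k) ++_)) ρs)             ≡⟨ sumℚ-cong ρs (λ ρ∈ → weightOf-replicate w k m _ (bounded ρ∈)) ⟩
    sumℚ (map (λ ρ → w (suc k) m * weightOf w k ρ) ρs)         ≡⟨ sumℚ-distribˡ (w (suc k) m) (weightOf w k) ρs ⟩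
    w (suc k) m * sumℚ (map (weightOf w k) ρs)                 ≡⟨ cong (w (suc k) m *_) (sum-partitionsUpTo w k _) ⟩
    w (suc k) m * partitionSum w k (n ∸ suc k ℕ.* m)           ∎
    where
    ρs = partitionsUpTo k (n ∸ suc k ℕ.* m)
    bounded : ∀ {ρ} → ρ ∈ ρs → Bounded k ρ
    bounded ρ∈ = proj₁ (partitionsUpTo-sound k _ ρ∈)

IsPartition⇒Bounded : ∀ ν → IsPartition ν → Bounded (size ν) ν
IsPartition⇒Bounded []      _                = tt
IsPartition⇒Bounded (x ∷ ν) (positive , linked) = bounded x ν positive linked (ℕP.m≤m+n x (size ν))
  where
  bounded : ∀ {K} x ν → All (0 <_) (x ∷ ν) → Linked ℕ._≥_ (x ∷ ν) → x ≤ K → Bounded K (x ∷ ν)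
  bounded x []      (0<x ∷ [])  [-]          x≤K = 0<x , x≤K , tt
  bounded x (y ∷ ν) (0<x ∷ pos) (x≥y ∷ lnk) x≤K = 0<x , x≤K , bounded y ν pos lnk x≥y

Bounded⇒IsPartition : ∀ k ν → Bounded k ν → IsPartition ν
Bounded⇒IsPartition k []          _                  = [] , []
Bounded⇒IsPartition k (x ∷ [])    (0<x , _ , _)      = 0<x ∷ [] , [-]
Bounded⇒IsPartition k (x ∷ y ∷ ν) (0<x , _ , bd) =
  let pos , lnk = Bounded⇒IsPartition x (y ∷ ν) bd in 0<x ∷ pos , proj₁ (proj₂ bd) ∷ lnk

∈⇒≤size : ∀ {x} ν → x ∈ ν → x ≤ size ν
∈⇒≤size (y ∷ ν) (here refl) = ℕP.m≤m+n y (size ν)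
∈⇒≤size (y ∷ ν) (there x∈) = ℕP.≤-trans (∈⇒≤size ν x∈) (ℕP.m≤n+m (size ν) y)

mult-beyondSize : ∀ γ j → size γ ≤ j → mult (suc j) γ ≡ 0
mult-beyondSize γ j |γ|≤j = mult-absent (suc j) γ λ 1+j∈ → ℕP.<⇒≱ (s≤s |γ|≤j) (∈⇒≤size γ 1+j∈)

mult-zero : ∀ γ → All (0 <_) γ → mult 0 γ ≡ 0
mult-zero γ pos = mult-absent 0 γ λ 0∈ → ℕP.<-irrefl refl (All.lookup pos 0∈)

fromℕ-product : ∀ xs → fromℕ (NL.product xs) ≡ prodℚ (map fromℕ xs)
fromℕ-product []       = refl
fromℕ-product (x ∷ xs) = ≡-trans (fromℕ-homo-* x (NL.product xs)) (cong (fromℕ x *_) (fromℕ-product xs))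

recip-product : ∀ xs → recip (NL.product xs) ≡ prodℚ (map recip xs)
recip-product []       = refl
recip-product (x ∷ xs) = ≡-trans (recip-homo-* x (NL.product xs)) (cong (recip x *_) (recip-product xs))

pBoldAt≡∏charlier : ∀ γ ν n → size γ ≤ n → All (0 <_) ν →
  pBoldAt γ ν ≡ ∏[ j < n ] charlier (suc j) (mult (suc j) γ) (fromℕ (mult (suc j) ν))
pBoldAt≡∏charlier γ ν n |γ|≤n pos = begin
  pBoldAt γ ν
    ≡⟨ prodℚ-applyUpTo (λ i → pPowAt ν i (mult i γ)) suc (size γ) ⟩
  ∏[ j < size γ ] charlier (suc j) (mult (suc j) γ) (qAt ν (suc j))
    ≡⟨ ∏-cong (size γ) (λ j _ → cong (charlier (suc j) (mult (suc j) γ)) (qAt≡mult j ν pos)) ⟩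
  ∏[ j < size γ ] charlier (suc j) (mult (suc j) γ) (fromℕ (mult (suc j) ν))
    ≡⟨ ∏-truncate _ (size γ) n (λ j |γ|≤j → cong (λ r → charlier (suc j) r _) (mult-beyondSize γ j |γ|≤j)) |γ|≤n ⟨
  ∏[ j < n ] charlier (suc j) (mult (suc j) γ) (fromℕ (mult (suc j) ν)) ∎
  where open ≡-Reasoning

invZ≡∏invZWeight : ∀ ν → invZ ν ≡ ∏[ j < size ν ] invZWeight (suc j) (mult (suc j) ν)
invZ≡∏invZWeight ν = begin
  invZ ν                                         ≡⟨ invZ≡recip ⟩
  recip (zee ν)                                  ≡⟨ recip-product (map zFactor (oneTo (size ν))) ⟩
  prodℚ (map recip (map zFactor (oneTo (size ν)))) ≡⟨ cong prodℚ (LP.map-∘ {g = recip} {f = zFactor} (oneTo (size ν))) ⟨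
  prodℚ (map (recip ∘ zFactor) (oneTo (size ν)))  ≡⟨ prodℚ-applyUpTo (recip ∘ zFactor) suc (size ν) ⟩
  ∏[ j < size ν ] invZWeight (suc j) (mult (suc j) ν) ∎
  where
  open ≡-Reasoning
  zFactor : ℕ → ℕ
  zFactor i = mult i ν ! ℕ.* i ^ mult i ν
  invZ≡recip : invZ ν ≡ recip (zee ν)
  invZ≡recip with zee ν
  ... | zero  = refl
  ... | suc _ = refl

multiplicities : List ℕ → ℕ → ℕ
multiplicities γ i = mult i γ

integrand≡weightOf : ∀ la mu n ν → size la ≤ n → size mu ≤ n → All (0 <_) ν → size ν ≡ n →
  pBoldAt la ν * pBoldAt mu ν * invZ ν ≡ weightOf (charlierWeight (multiplicities la) (multiplicities mu)) n ν
integrand≡weightOf la mu n ν |la|≤n |mu|≤n pos |ν|≡n = begin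
  pBoldAt la ν * pBoldAt mu ν * invZ ν
    ≡⟨ cong₂ _*_ (cong₂ _*_ (pBoldAt≡∏charlier la ν n |la|≤n pos) (pBoldAt≡∏charlier mu ν n |mu|≤n pos))
                 (≡-trans (invZ≡∏invZWeight ν) (cong (∏ (λ j → ι j)) |ν|≡n)) ⟩
  ∏ A n * ∏ B n * ∏ ι n   ≡⟨ cong (_* ∏ ι n) (∏-distrib-* A B n) ⟨
  ∏[ j < n ] (A j * B j) * ∏ ι n ≡⟨ ∏-distrib-* (λ j → A j * B j) ι n ⟨
  ∏[ j < n ] (A j * B j * ι j)   ∎
  where
  open ≡-Reasoning
  A B ι : ℕ → ℚ
  A j = charlier (suc j) (mult (suc j) la) (fromℕ (mult (suc j) ν))
  B j = charlier (suc j) (mult (suc j) mu) (fromℕ (mult (suc j) ν))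
  ι j = invZWeight (suc j) (mult (suc j) ν)

∑ℕ-mult≡size : ∀ n γ → All (0 <_) γ → All (_≤ n) γ → ∑ℕ[ j < n ] (suc j ℕ.* mult (suc j) γ) ≡ size γ
∑ℕ-mult≡size n []       _            _            = ∑ℕ-zero _ n λ j _ → ℕP.*-zeroʳ (suc j)
∑ℕ-mult≡size n (suc x ∷ γ) (_ ∷ pos) (1+x≤n ∷ ≤n) = ≡-trans
  (∑ℕ-addAt _ (λ j → suc j ℕ.* mult (suc j) γ) (suc x) n x 1+x≤n
    (≡-trans (cong (suc x ℕ.*_) (mult-replicate-same 1 (suc x) γ)) (ℕP.*-suc (suc x) _))
    (λ j _ j≢x → cong (suc j ℕ.*_) (mult-replicate-other (suc j) 1 (suc x) γ (j≢x ∘ sym ∘ ℕP.suc-injective))))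
  (cong (suc x ℕ.+_) (∑ℕ-mult≡size n γ pos ≤n))

weightedDegree-sizes : ∀ la mu n → IsPartition la → IsPartition mu → size la ≤ n → size mu ≤ n →
  weightedDegree (multiplicities la) (multiplicities mu) n ≡ size la ℕ.+ size mu
weightedDegree-sizes la mu n (pos-la , _) (pos-mu , _) |la|≤n |mu|≤n = begin
  ∑ℕ[ j < n ] (suc j ℕ.* (mult (suc j) la ℕ.+ mult (suc j) mu))
    ≡⟨ ∑ℕ-cong n (λ j _ → ℕP.*-distribˡ-+ (suc j) (mult (suc j) la) (mult (suc j) mu)) ⟩
  ∑ℕ[ j < n ] (suc j ℕ.* mult (suc j) la ℕ.+ suc j ℕ.* mult (suc j) mu)
    ≡⟨ ∑ℕ-distrib-+ (λ j → suc j ℕ.* mult (suc j) la) (λ j → suc j ℕ.* mult (suc j) mu) n ⟩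
  ∑ℕ[ j < n ] (suc j ℕ.* mult (suc j) la) ℕ.+ ∑ℕ[ j < n ] (suc j ℕ.* mult (suc j) mu)
    ≡⟨ cong₂ ℕ._+_ (∑ℕ-mult≡size n la pos-la (parts≤ la |la|≤n)) (∑ℕ-mult≡size n mu pos-mu (parts≤ mu |mu|≤n)) ⟩
  size la ℕ.+ size mu ∎
  where
  open ≡-Reasoning
  parts≤ : ∀ γ → size γ ≤ n → All (_≤ n) γ
  parts≤ γ |γ|≤n = All.tabulate λ x∈ → ℕP.≤-trans (∈⇒≤size γ x∈) |γ|≤n

∉-above-head : ∀ {z x} ν → Linked ℕ._≥_ (x ∷ ν) → x < z → z ∉ x ∷ ν
∉-above-head ν lnk x<z z∈ =
  ℕP.<⇒≱ x<z (All.lookup (LinkedP.Linked⇒All (λ a≥b b≥c → ℕP.≤-trans b≥c a≥b) ℕP.≤-refl lnk) z∈)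

multiplicities-injective : ∀ la mu → IsPartition la → IsPartition mu → (∀ i → mult i la ≡ mult i mu) → la ≡ mu
multiplicities-injective []       []       _ _ _  = refl
multiplicities-injective []       (y ∷ mu) _ _ eq = contradiction (≡-trans (eq y) (mult-replicate-same 1 y mu)) λ ()
multiplicities-injective (x ∷ la) []       _ _ eq = contradiction (≡-trans (sym (eq x)) (mult-replicate-same 1 x la)) λ ()
multiplicities-injective (x ∷ la) (y ∷ mu) (_ ∷ pos-la , lnk-la) (_ ∷ pos-mu , lnk-mu) eq with ℕP.<-cmp x y
... | tri< x<y _ _ = contradiction (≡-trans (sym (mult-absent y (x ∷ la) (∉-above-head la lnk-la x<y)))
                                            (≡-trans (eq y) (mult-replicate-same 1 y mu))) λ ()
... | tri> _ _ y<x = contradiction (≡-trans (sym (mult-absent x (y ∷ mu) (∉-above-head mu lnk-mu y<x)))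
                                            (≡-trans (sym (eq x)) (mult-replicate-same 1 x la))) λ ()
... | tri≈ _ refl _ = cong (x ∷_) (multiplicities-injective la mu (pos-la , tail lnk-la) (pos-mu , tail lnk-mu) eq′)
  where
  tail : ∀ {ν} → Linked ℕ._≥_ (x ∷ ν) → Linked ℕ._≥_ ν
  tail [-]       = []
  tail (_ ∷ lnk) = lnk
  eq′ : ∀ i → mult i la ≡ mult i mu
  eq′ i with x ℕ.≟ i
  ... | yes refl = ℕP.suc-injective (≡-trans (sym (mult-replicate-same 1 x la)) (≡-trans (eq x) (mult-replicate-same 1 x mu)))
  ... | no  x≢i  = ≡-trans (sym (mult-replicate-other i 1 x la x≢i)) (≡-trans (eq i) (mult-replicate-other i 1 x mu x≢i))

zDelta-refl : ∀ la → zDelta la la ≡ fromℕ (zee la)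
zDelta-refl la = if-⌊yes⌋ (LP.≡-dec ℕ._≟_ la la) refl

zDelta-≢ : ∀ {la mu} → la ≢ mu → zDelta la mu ≡ 0ℚ
zDelta-≢ {la} {mu} = if-⌊no⌋ (LP.≡-dec ℕ._≟_ la mu)

normProduct-diagonal : ∀ la n → size la ≤ n → normProduct (multiplicities la) (multiplicities la) n ≡ fromℕ (zee la)
normProduct-diagonal la n |la|≤n = begin
  ∏[ j < n ] charlierNorm (suc j) (mult (suc j) la) (mult (suc j) la)
    ≡⟨ ∏-cong n (λ j _ → charlierNorm-refl (suc j) (mult (suc j) la)) ⟩
  ∏[ j < n ] fromℕ (zFactor (suc j))
    ≡⟨ ∏-truncate _ (size la) n (λ j |la|≤j → cong (λ r → fromℕ (r ! ℕ.* suc j ^ r)) (mult-beyondSize la j |la|≤j)) |la|≤n ⟩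
  ∏[ j < size la ] fromℕ (zFactor (suc j))
    ≡⟨ prodℚ-applyUpTo (fromℕ ∘ zFactor) suc (size la) ⟨
  prodℚ (map (fromℕ ∘ zFactor) (oneTo (size la)))
    ≡⟨ cong prodℚ (LP.map-∘ {g = fromℕ} {f = zFactor} (oneTo (size la))) ⟩
  prodℚ (map fromℕ (map zFactor (oneTo (size la))))
    ≡⟨ fromℕ-product (map zFactor (oneTo (size la))) ⟨
  fromℕ (zee la) ∎
  where
  open ≡-Reasoning
  zFactor : ℕ → ℕ
  zFactor i = mult i la ! ℕ.* i ^ mult i la

normProduct-offDiagonal : ∀ la mu n → IsPartition la → IsPartition mu → size la ≤ n → size mu ≤ n → la ≢ mu →
  normProduct (multiplicities la) (multiplicities mu) n ≡ 0ℚ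
normProduct-offDiagonal la mu n part-la part-mu |la|≤n |mu|≤n la≢mu = cases (ℕP.anyUpTo? (λ j → ¬? (mult (suc j) la ℕ.≟ mult (suc j) mu)) n)
  where
  cases : Dec (∃[ j ] (j < n × mult (suc j) la ≢ mult (suc j) mu)) → normProduct (multiplicities la) (multiplicities mu) n ≡ 0ℚ
  cases (yes (j , j<n , differ)) = ∏-zeroFactor _ n j j<n (charlierNorm-≢ (suc j) differ)
  cases (no  none)               = contradiction (multiplicities-injective la mu part-la part-mu same) la≢mu
    where
    same : ∀ i → mult i la ≡ mult i mu
    same zero    = ≡-trans (mult-zero la (proj₁ part-la)) (sym (mult-zero mu (proj₁ part-mu)))
    same (suc j) with j <? n | mult (suc j) la ℕ.≟ mult (suc j) mu
    ... | _       | yes eq     = eq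
    ... | yes j<n | no  differ = contradiction (j , j<n , differ) none
    ... | no  j≮n | no  _      = ≡-trans (mult-beyondSize la j (ℕP.≤-trans |la|≤n (ℕP.≮⇒≥ j≮n)))
                                         (sym (mult-beyondSize mu j (ℕP.≤-trans |mu|≤n (ℕP.≮⇒≥ j≮n))))

normProduct≡zDelta : ∀ la mu n → IsPartition la → IsPartition mu → size la ≤ n → size mu ≤ n →
  normProduct (multiplicities la) (multiplicities mu) n ≡ zDelta la mu
normProduct≡zDelta la mu n part-la part-mu |la|≤n |mu|≤n = cases (LP.≡-dec ℕ._≟_ la mu)
  where
  cases : Dec (la ≡ mu) → normProduct (multiplicities la) (multiplicities mu) n ≡ zDelta la mu
  cases (yes refl)  = ≡-trans (normProduct-diagonal la n |la|≤n) (sym (zDelta-refl la))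
  cases (no  la≢mu) = ≡-trans (normProduct-offDiagonal la mu n part-la part-mu |la|≤n |mu|≤n la≢mu) (sym (zDelta-≢ la≢mu))

↭-partitionsUpTo : ∀ n L → Unique L → (∀ ν → ν ∈ L → IsPartition ν × size ν ≡ n) →
  (∀ ν → IsPartition ν → size ν ≡ n → ν ∈ L) → L ↭ partitionsUpTo n n
↭-partitionsUpTo n L unique-L sound-L complete-L = unique-↭ unique-L (partitionsUpTo-unique n n)
  (λ {ν} ν∈ → let part , |ν|≡n = sound-L ν ν∈ in
    partitionsUpTo-complete n n ν (subst (λ k → Bounded k ν) |ν|≡n (IsPartition⇒Bounded ν part)) |ν|≡n)
  (λ {ν} ν∈ → let bounded , |ν|≡n = partitionsUpTo-sound n n ν∈ in complete-L ν (Bounded⇒IsPartition n ν bounded) |ν|≡n)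

+≤2*⊔ : ∀ a b → a ℕ.+ b ≤ 2 ℕ.* (a ⊔ b)
+≤2*⊔ a b = subst (a ℕ.+ b ≤_) (cong ((a ⊔ b) ℕ.+_) (sym (ℕP.+-identityʳ (a ⊔ b))))
                  (ℕP.+-mono-≤ (ℕP.m≤m⊔n a b) (ℕP.m≤n⊔m a b))

mainTheorem2 : (la mu : List ℕ) → IsPartition la → IsPartition mu →
    (n : ℕ) → 2 ℕ.* (size la ⊔ size mu) ≤ n →
    (L : List (List ℕ)) → Unique L →
    (∀ ν → ν ∈ L → IsPartition ν × size ν ≡ n) →
    (∀ ν → IsPartition ν → size ν ≡ n → ν ∈ L) →
    atSum la mu L ≡ zDelta la mu
mainTheorem2 la mu part-la part-mu n bound L unique-L sound-L complete-L = begin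
  atSum la mu L                                  ≡⟨ sumℚ-↭ integrand (↭-partitionsUpTo n L unique-L sound-L complete-L) ⟩
  sumℚ (map integrand (partitionsUpTo n n))      ≡⟨ sumℚ-cong (partitionsUpTo n n) integrand≡ ⟩
  sumℚ (map (weightOf W n) (partitionsUpTo n n)) ≡⟨ sum-partitionsUpTo W n n ⟩
  partitionSum W n n                             ≡⟨ orthogonality (degree a b n) n a b n ℕP.≤-refl wdeg≤n ℕP.≤-refl ⟩
  normProduct a b n                              ≡⟨ normProduct≡zDelta la mu n part-la part-mu |la|≤n |mu|≤n ⟩
  zDelta la mu                                   ∎
  where
  open ≡-Reasoning
  a b : ℕ → ℕ
  a = multiplicities la
  b = multiplicities mu
  W : Weights
  W = charlierWeight a b
  integrand : List ℕ → ℚ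
  integrand ν = pBoldAt la ν * pBoldAt mu ν * invZ ν
  |la|+|mu|≤n = ℕP.≤-trans (+≤2*⊔ (size la) (size mu)) bound
  |la|≤n = ℕP.≤-trans (ℕP.m≤m+n (size la) (size mu)) |la|+|mu|≤n
  |mu|≤n = ℕP.≤-trans (ℕP.m≤n+m (size mu) (size la)) |la|+|mu|≤n
  wdeg≤n = subst (_≤ n) (sym (weightedDegree-sizes la mu n part-la part-mu |la|≤n |mu|≤n)) |la|+|mu|≤n
  integrand≡ : ∀ {ν} → ν ∈ partitionsUpTo n n → integrand ν ≡ weightOf W n ν
  integrand≡ {ν} ν∈ = let bounded , |ν|≡n = partitionsUpTo-sound n n ν∈ in
    integrand≡weightOf la mu n ν |la|≤n |mu|≤n (proj₁ (Bounded⇒IsPartition n ν bounded)) |ν|≡n
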